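{- Let $n\ge4$ and $1<m<n-1$. Then $$W^m_{n-1}=\big(W^1_{n-m-1}\times W^{m-1}_{m-1}\big)\cup\big(W^1_{n-m-1}\times W^{m-1}_{m-1}\big)w_{n-1},$$ where an element of $W^1_{n-m-1}\times W^{m-1}_{m-1}\subset S_{n-m}\times S_m$ is regarded as the permutation of $\{1,\dots,n\}$ acting by the first factor on $\{1,\dots,n-m\}$ and by the second factor on $\{n-m+1,\dots,n\}$ (via the shift $i\mapsto i+n-m$), and $w_{n-1}\in S_n$ is the longest element, $w_{n-1}(i)=n+1-i$.
   Context: For $k\ge1$, type $A_k$: $\alpha_{i,j}=e_i-e_j$, simple roots $\alpha_i=\alpha_{i,i+1}$; $S_{k+1}$ acts by $e_a\mapsto e_{w(a)}$; $|\beta|$ is whichever of $\pm\beta$ is positive; $C(S)=\sum_{\alpha\in S}\mathbb{R}_{\ge0}\alpha$; interiors $(\cdot)^\circ$ are taken in $\{x\in\mathbb{R}^{k+1}:\sum x_i=0\}$. Chambers: $\mathfrak{a}^1_k=C(\alpha_{1,2},\dots,\alpha_{1,k+1})$; $\mathfrak{a}^k_k=C(\alpha_{k,k+1},\dots,\alpha_{1,k+1})$; and for $1<m<n-1$, $\mathfrak{a}^m_{n-1}=C(\alpha_{1,2},\dots,\alpha_{1,n-m},\alpha_{n-1,n},\dots,\alpha_{n-m+1,n},\alpha_{1,n})=\{\sum a_i\alpha_i:a_1\ge\cdots\ge a_{n-m}\le\cdots\le a_{n-1}\}$ in type $A_{n-1}$. For any such chamber $\mathfrak{a}$ in type $A_k$,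 set $W(\mathfrak{a})=\{w\in S_{k+1}:\mathfrak{a}^\circ\subset C(|w\alpha_1|,\dots,|w\alpha_k|)\}$, and write $W^1_k=W(\mathfrak{a}^1_k)$, $W^k_k=W(\mathfrak{a}^k_k)$, $W^m_{n-1}=W(\mathfrak{a}^m_{n-1})$.
   Formalization: The cones $C(S)$, their interiors and the sets $W(\mathfrak{a})$ are taken over ℚ instead of ℝ: points have rational coordinates, and cone coefficients and the radii defining interiors are rational. -}

module Defs where

open import Data.Nat as ℕ using (ℕ; _∸_; _≟_; _<ᵇ_)
open import Data.Nat.Properties using (m∸n+n≡m)
open import Data.Fin using (Fin; toℕ; zero; suc; inject₁; splitAt; cast; _↑ˡ_; _↑ʳ_)
open import Data.Rational as ℚ using (ℚ; 0ℚ; 1ℚ; _-_; _*_; _<_; _≤_; ∣_∣)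
open import Data.List as List using (List; []; _∷_; _++_; map; upTo; allFin)
open import Data.Product using (Σ; _×_; _,_; ∃)
open import Data.Sum using (_⊎_; inj₁; inj₂)
open import Data.Bool using (if_then_else_)
open import Relation.Binary.PropositionalEquality using (_≡_; sym)
open import Relation.Nullary.Decidable using (does)
open import Data.Fin.Permutation using (Permutation′; _⟨$⟩ʳ_)

-- Vectors of ℝ^N (rational points) as functions Fin N → ℚ.
Vect : ℕ → Set
Vect N = Fin N → ℚ

sumV : ∀ {N} → Vect N → ℚ
sumV {ℕ.zero}  x = 0ℚ
sumV {ℕ.suc N} x = x zero ℚ.+ sumV (λ i → x (suc i))

-- standard basis vector e_p, with 1-based label p ∈ {1,…,N}
e : ∀ {N} → ℕ → Vect N
e p i = if does (ℕ.suc (toℕ i) ≟ p) then 1ℚ else 0ℚ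

α : ∀ {N} → ℕ → ℕ → Vect N
α p q i = e p i - e q i

αF : ∀ {N} → Fin N → Fin N → Vect N
αF p q = α (ℕ.suc (toℕ p)) (ℕ.suc (toℕ q))

-- |α_{p,q}| : the positive one of ±α_{p,q} (positive roots are α_{p,q}, p < q)
absα : ∀ {N} → Fin N → Fin N → Vect N
absα p q = if toℕ p <ᵇ toℕ q then αF p q else αF q p

InCone : ∀ {N} → List (Vect N) → Vect N → Set
InCone []       x = ∀ i → x i ≡ 0ℚ
InCone (g ∷ gs) x = Σ ℚ λ c → (0ℚ ℚ.≤ c) × InCone gs (λ i → x i - c * g i)

-- interior of C(S) inside the hyperplane {Σ x_i = 0} (sup-norm balls)
InInterior : ∀ {N} → List (Vect N) → Vect N → Set
InInterior S x =
  (sumV x ≡ 0ℚ) ×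
  Σ ℚ λ ε → (0ℚ < ε) ×
    (∀ y → sumV y ≡ 0ℚ → (∀ i → ∣ y i - x i ∣ < ε) → InCone S y)

range : ℕ → ℕ → List ℕ
range a b = map (a ℕ.+_) (upTo (ℕ.suc b ∸ a))

-- pairs (i, i+1) of consecutive elements of Fin N, i.e. simple roots α_1,…,α_{N-1}
consec : ∀ N → List (Fin N × Fin N)
consec ℕ.zero    = []
consec (ℕ.suc N) = map (λ i → inject₁ i , suc i) (allFin N)

-- { |w α_1|, …, |w α_{N-1}| }  for w ∈ S_N  (w e_a = e_{w(a)}, so w α_{a,b} = α_{w a, w b})
wSimple : ∀ {N} → Permutation′ N → List (Vect N)
wSimple {N} w = map (λ { (i , j) → absα (w ⟨$⟩ʳ i) (w ⟨$⟩ʳ j) }) (consec N)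

W : ∀ N → List (Vect N) → Permutation′ N → Set
W N gens w = ∀ x → InInterior gens x → InCone (wSimple w) x

-- chambers in type A_{N-1} (so k = N-1)
-- 𝔞^1_k = C(α_{1,2},…,α_{1,k+1})
gens1 : ∀ N → List (Vect N)
gens1 N = map (α 1) (range 2 N)

gensTop : ∀ N → List (Vect N)
gensTop N = map (λ j → α j N) (range 1 (N ∸ 1))

gensMid : ∀ n → ℕ → List (Vect n)
gensMid n m =
  map (α 1) (range 2 (n ∸ m)) ++
  map (λ j → α j n) (range (ℕ.suc (n ∸ m)) (n ∸ 1)) ++
  (α 1 n ∷ [])

-- block permutation (u, v) ∈ S_{n-m} × S_m acting on {1..n}: u on {1..n-m},
-- v on {n-m+1..n} via the shift i ↦ i + (n-m)
block : ∀ n m → m ℕ.≤ n → Permutation′ (n ∸ m) → Permutation′ m → Fin n → Fin n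
block n m m≤n u v i with splitAt (n ∸ m) (cast (sym (m∸n+n≡m m≤n)) i)
... | inj₁ j = cast (m∸n+n≡m m≤n) ((u ⟨$⟩ʳ j) ↑ˡ m)
... | inj₂ j = cast (m∸n+n≡m m≤n) ((n ∸ m) ↑ʳ (v ⟨$⟩ʳ j))

{-# OPTIONS --safe #-}
module Submission where

-- For a permutation w of {0,…,n}, the vectors |wα₁|,…,|wαₙ| form a basis of the hyperplane
-- Σ xᵢ = 0 whose dual basis is, up to the sign recording whether w ascends at t, the indicator
-- of the first t+1 positions of w.  So C(|wαₜ|) is cut out by "signed prefix sums ≥ 0", and for
-- a chamber 𝔞 spanned by roots and with nonempty interior, w ∈ W(𝔞) iff every generator α_{a,c}
-- of 𝔞 lies in that cone, i.e. iff the values of w increase along the positions from w⁻¹(a)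
-- to w⁻¹(c).  All three chambers are double stars on {0,…,n}: edges 0–a for 1 ≤ a < f, a–n for
-- f ≤ a < n, and 0–n (f = n for 𝔞¹, f = 1 for 𝔞ᵏ).  For the middle chamber, if w⁻¹(0) comes
-- before w⁻¹(n) these monotonicity conditions force the values below f onto the first f
-- positions, and then they split into the star condition on the first block and the top
-- condition on the second.  The other order is the mirror image: w w₀ has the same |wαₜ| as w,
-- listed backwards, so W(𝔞) is closed under w ↦ w w₀.

open import Defs
open import Data.Nat as ℕ using (ℕ; suc)
open import Data.Fin using (Fin)
open import Data.Fin.Permutation using (Permutation′)

module Sums where
  open import Data.Nat as ℕ using (zero; suc)
  import Data.Nat.Properties as ℕ
  open import Data.Fin using (toℕ; zero; suc)
  import Data.Fin.Properties as Fin
  open import Data.Rational using (ℚ; 0ℚ; 1ℚ; _+_; _*_; _-_; -_; _≤_; _<_; ∣_∣; 1/_; NonZero; Positive; nonNegative; positive)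
  import Data.Rational.Properties as ℚ
  open import Data.Rational.Solver using (module +-*-Solver)
  open import Algebra.Bundles using (CommutativeRing)
  open import Algebra.Properties.Semiring.Sum (CommutativeRing.semiring ℚ.+-*-commutativeRing) public
    using (sum; sum-cong-≗; ∑-distrib-+; *-distribˡ-sum; *-distribʳ-sum; ∑-comm; sum-init-last; ∑-permute)
  open import Relation.Binary.PropositionalEquality
  open import Relation.Nullary using (Dec; does; yes; no; ¬_)
  open import Relation.Nullary.Decidable using (dec-true; dec-false)
  open import Function using (_∘_)
  open import Data.Sum using (inj₁; inj₂)
  open import Data.Empty using (⊥-elim)
  open import Data.Bool using (if_then_else_)
  open +-*-Solver

  private variable
    N : ℕ
    x y : Vect N

  0≤1 : 0ℚ ≤ 1ℚ
  0≤1 = ℚ.<⇒≤ (ℚ.positive⁻¹ 1ℚ)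

  nonneg-* : ∀ {a b} → 0ℚ ≤ a → 0ℚ ≤ b → 0ℚ ≤ a * b
  nonneg-* {a} {b} 0≤a 0≤b = subst (_≤ a * b) (ℚ.*-zeroˡ b) (ℚ.*-monoʳ-≤-nonNeg b {{nonNegative 0≤b}} 0≤a)

  nonneg-+ : ∀ {a b} → 0ℚ ≤ a → 0ℚ ≤ b → 0ℚ ≤ a + b
  nonneg-+ = ℚ.+-mono-≤

  sumV≡sum : (x : Vect N) → sumV x ≡ sum x
  sumV≡sum {zero}  x = refl
  sumV≡sum {suc N} x = cong (x zero +_) (sumV≡sum (λ i → x (suc i)))

  ∑-zero : (∀ i → x i ≡ 0ℚ) → sum x ≡ 0ℚ
  ∑-zero {zero}  x≡0 = refl
  ∑-zero {suc N} x≡0 = cong₂ _+_ (x≡0 zero) (∑-zero (λ i → x≡0 (suc i)))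

  ∑-mono : (∀ i → x i ≤ y i) → sum x ≤ sum y
  ∑-mono {zero}  x≤y = ℚ.≤-refl
  ∑-mono {suc N} x≤y = ℚ.+-mono-≤ (x≤y zero) (∑-mono (λ i → x≤y (suc i)))

  ∑-neg : (x : Vect N) → sum (λ i → - x i) ≡ - sum x
  ∑-neg {zero}  x = refl
  ∑-neg {suc N} x = trans (cong (- x zero +_) (∑-neg (λ i → x (suc i))))
                          (solve 2 (λ a b → :- a :+ :- b := :- (a :+ b)) refl (x zero) (sum (λ i → x (suc i))))

  ∑-sub : (x y : Vect N) → sum (λ i → x i - y i) ≡ sum x - sum y
  ∑-sub x y = trans (∑-distrib-+ x (λ i → - y i)) (cong (sum x +_) (∑-neg y))

  sumV-+ : ∀ (x y : Vect N) → sumV (λ i → x i + y i) ≡ sumV x + sumV y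
  sumV-+ x y = trans (sumV≡sum (λ i → x i + y i)) (trans (∑-distrib-+ x y) (sym (cong₂ _+_ (sumV≡sum x) (sumV≡sum y))))

  sumV-− : ∀ (x y : Vect N) → sumV (λ i → x i - y i) ≡ sumV x - sumV y
  sumV-− x y = trans (sumV≡sum (λ i → x i - y i)) (trans (∑-sub x y) (sym (cong₂ _-_ (sumV≡sum x) (sumV≡sum y))))

  sumV-* : ∀ c (x : Vect N) → sumV (λ i → c * x i) ≡ c * sumV x
  sumV-* c x = trans (sumV≡sum (λ i → c * x i)) (trans (sym (*-distribˡ-sum c x)) (cong (c *_) (sym (sumV≡sum x))))

  ⟪_,_⟫ : Vect N → Vect N → ℚ
  ⟪ μ , x ⟫ = sum (λ k → μ k * x k)

  ⟪⟫-comm : ∀ (μ x : Vect N) → ⟪ μ , x ⟫ ≡ ⟪ x , μ ⟫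
  ⟪⟫-comm μ x = sum-cong-≗ (λ k → ℚ.*-comm (μ k) (x k))

  ⟪⟫-negˡ : ∀ (μ x : Vect N) → ⟪ (λ k → - μ k) , x ⟫ ≡ - ⟪ μ , x ⟫
  ⟪⟫-negˡ μ x = trans (sum-cong-≗ (λ k → sym (ℚ.neg-distribˡ-* (μ k) (x k)))) (∑-neg (λ k → μ k * x k))

  ⟪⟫-cong : ∀ (μ : Vect N) → x ≗ y → ⟪ μ , x ⟫ ≡ ⟪ μ , y ⟫
  ⟪⟫-cong μ x≗y = sum-cong-≗ (λ k → cong (μ k *_) (x≗y k))

  ⟪⟫-congˡ : ∀ {μ ν : Vect N} x → μ ≗ ν → ⟪ μ , x ⟫ ≡ ⟪ ν , x ⟫
  ⟪⟫-congˡ x μ≗ν = sum-cong-≗ (λ k → cong (_* x k) (μ≗ν k))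

  ⟪⟫-zero : ∀ (μ : Vect N) → (∀ i → x i ≡ 0ℚ) → ⟪ μ , x ⟫ ≡ 0ℚ
  ⟪⟫-zero μ x≡0 = ∑-zero (λ k → trans (cong (μ k *_) (x≡0 k)) (ℚ.*-zeroʳ (μ k)))

  ⟪⟫-+ : ∀ (μ : Vect N) x y → ⟪ μ , (λ i → x i + y i) ⟫ ≡ ⟪ μ , x ⟫ + ⟪ μ , y ⟫
  ⟪⟫-+ μ x y = trans (sum-cong-≗ (λ k → ℚ.*-distribˡ-+ (μ k) (x k) (y k))) (∑-distrib-+ (λ k → μ k * x k) (λ k → μ k * y k))

  ⟪⟫-* : ∀ (μ : Vect N) c x → ⟪ μ , (λ i → c * x i) ⟫ ≡ c * ⟪ μ , x ⟫
  ⟪⟫-* μ c x = trans (sum-cong-≗ (λ k → solve 3 (λ m c x → m :* (c :* x) := c :* (m :* x)) refl (μ k) c (x k)))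
                     (sym (*-distribˡ-sum c (λ k → μ k * x k)))

  ⟪⟫-− : ∀ (μ : Vect N) x y → ⟪ μ , (λ i → x i - y i) ⟫ ≡ ⟪ μ , x ⟫ - ⟪ μ , y ⟫
  ⟪⟫-− μ x y = trans (sum-cong-≗ (λ k → solve 3 (λ m x y → m :* (x :- y) := m :* x :- m :* y) refl (μ k) (x k) (y k)))
                     (∑-sub (λ k → μ k * x k) (λ k → μ k * y k))

  ⟪⟫-−* : ∀ (μ : Vect N) x c g → ⟪ μ , (λ i → x i - c * g i) ⟫ ≡ ⟪ μ , x ⟫ - c * ⟪ μ , g ⟫
  ⟪⟫-−* μ x c g = trans (⟪⟫-− μ x (λ i → c * g i)) (cong (λ q → ⟪ μ , x ⟫ - q) (⟪⟫-* μ c g))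

  sumV≡⟪1,_⟫ : (x : Vect N) → sumV x ≡ ⟪ (λ _ → 1ℚ) , x ⟫
  sumV≡⟪1,_⟫ x = trans (sumV≡sum x) (sum-cong-≗ (λ k → sym (ℚ.*-identityˡ (x k))))

  eF : Fin N → Vect N
  eF a = e (suc (toℕ a))

  𝟙 : {P : Set} → Dec P → ℚ
  𝟙 P? = if does P? then 1ℚ else 0ℚ

  𝟙-yes : {P : Set} (P? : Dec P) → P → 𝟙 P? ≡ 1ℚ
  𝟙-yes P? p = cong (λ b → if b then 1ℚ else 0ℚ) (dec-true P? p)

  𝟙-no : {P : Set} (P? : Dec P) → ¬ P → 𝟙 P? ≡ 0ℚ
  𝟙-no P? ¬p = cong (λ b → if b then 1ℚ else 0ℚ) (dec-false P? ¬p)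

  𝟙-⇔ : {P Q : Set} (P? : Dec P) (Q? : Dec Q) → (P → Q) → (Q → P) → 𝟙 P? ≡ 𝟙 Q?
  𝟙-⇔ (yes p) Q? P→Q Q→P = sym (𝟙-yes Q? (P→Q p))
  𝟙-⇔ (no ¬p) Q? P→Q Q→P = sym (𝟙-no Q? (¬p ∘ Q→P))

  eF-same : (a : Fin N) → eF a a ≡ 1ℚ
  eF-same a = 𝟙-yes (suc (toℕ a) ℕ.≟ suc (toℕ a)) refl

  eF-diff : {a b : Fin N} → a ≢ b → eF a b ≡ 0ℚ
  eF-diff {a = a} {b} a≢b = 𝟙-no (suc (toℕ b) ℕ.≟ suc (toℕ a)) (λ eq → a≢b (sym (Fin.toℕ-injective (ℕ.suc-injective eq))))

  eF-sym : (a b : Fin N) → eF a b ≡ eF b a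
  eF-sym a b with a Fin.≟ b
  ... | yes refl = refl
  ... | no a≢b   = trans (eF-diff a≢b) (sym (eF-diff (a≢b ∘ sym)))

  ⟪⟫-eF : ∀ (μ : Vect N) a → ⟪ μ , eF a ⟫ ≡ μ a
  ⟪⟫-eF {suc N} μ zero    = trans (cong₂ _+_ (ℚ.*-identityʳ (μ zero)) (∑-zero (λ k → ℚ.*-zeroʳ (μ (suc k)))))
                                  (ℚ.+-identityʳ (μ zero))
  ⟪⟫-eF {suc N} μ (suc a) = trans (cong₂ _+_ (ℚ.*-zeroʳ (μ zero)) (⟪⟫-eF (λ k → μ (suc k)) a))
                                  (ℚ.+-identityˡ (μ (suc a)))

  ⟪⟫-αF : ∀ (μ : Vect N) a b → ⟪ μ , αF a b ⟫ ≡ μ a - μ b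
  ⟪⟫-αF μ a b = trans (⟪⟫-− μ (eF a) (eF b)) (cong₂ _-_ (⟪⟫-eF μ a) (⟪⟫-eF μ b))

  ∑-star-out : ∀ (c : Vect N) p i → sum (λ a → c a * αF p a i) ≡ sum c * eF p i - c i
  ∑-star-out c p i = begin
    sum (λ a → c a * αF p a i)                          ≡⟨ sum-cong-≗ (λ a → ℚ.*-distribˡ-+ (c a) (eF p i) (- eF a i)) ⟩
    sum (λ a → c a * eF p i + c a * - eF a i)           ≡⟨ ∑-distrib-+ (λ a → c a * eF p i) (λ a → c a * - eF a i) ⟩
    sum (λ a → c a * eF p i) + sum (λ a → c a * - eF a i)
                                                        ≡⟨ cong₂ _+_ (sym (*-distribʳ-sum (eF p i) c))
                                                                     (trans (sum-cong-≗ (λ a → sym (ℚ.neg-distribʳ-* (c a) (eF a i)))) (∑-neg (λ a → c a * eF a i))) ⟩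
    sum c * eF p i - ⟪ c , (λ a → eF a i) ⟫              ≡⟨ cong (λ q → sum c * eF p i - q) (trans (⟪⟫-cong c (λ a → eF-sym a i)) (⟪⟫-eF c i)) ⟩
    sum c * eF p i - c i                                ∎
    where open ≡-Reasoning

  ∑-star-in : ∀ (c : Vect N) p i → sum (λ a → c a * αF a p i) ≡ c i - sum c * eF p i
  ∑-star-in c p i = begin
    sum (λ a → c a * αF a p i)           ≡⟨ sum-cong-≗ (λ a → solve 3 (λ c a p → c :* (a :- p) := :- (c :* (p :- a))) refl (c a) (eF a i) (eF p i)) ⟩
    sum (λ a → - (c a * αF p a i))       ≡⟨ ∑-neg (λ a → c a * αF p a i) ⟩
    - sum (λ a → c a * αF p a i)         ≡⟨ cong -_ (∑-star-out c p i) ⟩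
    - (sum c * eF p i - c i)             ≡⟨ solve 2 (λ s c → :- (s :- c) := c :- s) refl (sum c * eF p i) (c i) ⟩
    c i - sum c * eF p i                 ∎
    where open ≡-Reasoning

  ∑-eF* : ∀ (a : Fin N) q → sum (λ k → eF a k * q) ≡ q
  ∑-eF* a q = trans (⟪⟫-comm (eF a) (λ _ → q)) (⟪⟫-eF (λ _ → q) a)

  sumV-αF : ∀ (a b : Fin N) → sumV (αF a b) ≡ 0ℚ
  sumV-αF a b = trans (sumV≡⟪1,_⟫ (αF a b)) (trans (⟪⟫-αF (λ _ → 1ℚ) a b) (ℚ.+-inverseʳ 1ℚ))

  count : ℕ → ℚ
  count N = sum (λ (_ : Fin N) → 1ℚ)

  -∣p∣≤p : ∀ p → - ∣ p ∣ ≤ p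
  -∣p∣≤p p with ℚ.∣p∣≡p∨∣p∣≡-p p
  ... | inj₁ ∣p∣≡p  = ℚ.≤-trans (ℚ.neg-antimono-≤ (ℚ.0≤∣p∣ p)) (ℚ.∣p∣≡p⇒0≤p ∣p∣≡p)
  ... | inj₂ ∣p∣≡-p = ℚ.≤-reflexive (trans (cong -_ ∣p∣≡-p) (solve 1 (λ p → :- (:- p) := p) refl p))

  p≤∣p∣ : ∀ p → p ≤ ∣ p ∣
  p≤∣p∣ p = subst₂ _≤_ (neg-neg p) (trans (neg-neg ∣ - p ∣) (ℚ.∣-p∣≡∣p∣ p)) (ℚ.neg-antimono-≤ (-∣p∣≤p (- p)))
    where neg-neg = solve 1 (λ q → :- (:- q) := q) refl

  count-nonneg : ∀ N → 0ℚ ≤ count N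
  count-nonneg N = subst (_≤ count N) (∑-zero {N} {λ _ → 0ℚ} (λ _ → refl)) (∑-mono {N} {λ _ → 0ℚ} {λ _ → 1ℚ} (λ _ → 0≤1))

  ∣𝟙∣≤1 : {P : Set} (P? : Dec P) → ∣ 𝟙 P? ∣ ≤ 1ℚ
  ∣𝟙∣≤1 (yes _) = ℚ.≤-refl
  ∣𝟙∣≤1 (no _)  = 0≤1

  ⟪⟫-lower-bound : ∀ (μ d : Vect N) → (∀ k → ∣ μ k ∣ ≤ 1ℚ) → (∀ k → ∣ d k ∣ < 1ℚ) → - count N ≤ ⟪ μ , d ⟫
  ⟪⟫-lower-bound {N} μ d ∣μ∣≤1 ∣d∣<1 =
    subst (_≤ ⟪ μ , d ⟫) (∑-neg {N} (λ _ → 1ℚ)) (∑-mono termwise)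
    where
      ∣μd∣≤1 : ∀ k → ∣ μ k * d k ∣ ≤ 1ℚ
      ∣μd∣≤1 k = begin
        ∣ μ k * d k ∣      ≡⟨ ℚ.∣p*q∣≡∣p∣*∣q∣ (μ k) (d k) ⟩
        ∣ μ k ∣ * ∣ d k ∣  ≤⟨ ℚ.*-monoʳ-≤-nonNeg ∣ d k ∣ {{nonNegative (ℚ.0≤∣p∣ (d k))}} (∣μ∣≤1 k) ⟩
        1ℚ * ∣ d k ∣       ≡⟨ ℚ.*-identityˡ ∣ d k ∣ ⟩
        ∣ d k ∣            ≤⟨ ℚ.<⇒≤ (∣d∣<1 k) ⟩
        1ℚ                 ∎
        where open ℚ.≤-Reasoning
      termwise : ∀ k → - 1ℚ ≤ μ k * d k
      termwise k = ℚ.≤-trans (ℚ.neg-antimono-≤ (∣μd∣≤1 k)) (-∣p∣≤p (μ k * d k))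

  nonneg-if-shifts-nonneg : ∀ a c → (∀ M → 0ℚ ≤ M → 0ℚ ≤ a + M * c) → 0ℚ ≤ c
  nonneg-if-shifts-nonneg a c shifts with 0ℚ ℚ.≤? c
  ... | yes 0≤c = 0≤c
  ... | no  0≰c = ⊥-elim (ℚ.<-irrefl refl (ℚ.≤-<-trans (shifts M 0≤M) a+Mc<0))
    where
      p = - c
      0<p : 0ℚ < p
      0<p = subst (_< p) (solve 0 (:- con 0ℚ := con 0ℚ) refl) (ℚ.neg-antimono-< (ℚ.≰⇒> 0≰c))
      instance
        p>0 : Positive p
        p>0 = positive 0<p
        p≢0 : NonZero p
        p≢0 = ℚ.pos⇒nonZero p
      A = ∣ a ∣ + 1ℚ
      M = A * 1/ p
      0≤M : 0ℚ ≤ M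
      0≤M = nonneg-* (nonneg-+ (ℚ.0≤∣p∣ a) 0≤1)
                     (ℚ.<⇒≤ (ℚ.positive⁻¹ (1/ p) {{ℚ.1/pos⇒pos p}}))
      Mc≡-A : M * c ≡ - A
      Mc≡-A = begin
        A * 1/ p * c             ≡⟨ solve 3 (λ A q c → A :* q :* c := :- (A :* (q :* (:- c)))) refl A (1/ p) c ⟩
        - (A * (1/ p * p))       ≡⟨ cong (λ r → - (A * r)) (ℚ.*-inverseˡ p) ⟩
        - (A * 1ℚ)               ≡⟨ cong -_ (ℚ.*-identityʳ A) ⟩
        - A                      ∎
        where open ≡-Reasoning
      a+Mc<0 : a + M * c < 0ℚ
      a+Mc<0 = begin-strict
        a + M * c                ≡⟨ cong (a +_) Mc≡-A ⟩
        a + - A                  ≤⟨ ℚ.+-monoˡ-≤ (- A) (p≤∣p∣ a) ⟩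
        ∣ a ∣ + - A              ≡⟨ solve 1 (λ b → b :+ :- (b :+ con 1ℚ) := :- con 1ℚ) refl ∣ a ∣ ⟩
        - 1ℚ                     <⟨ ℚ.negative⁻¹ (- 1ℚ) ⟩
        0ℚ                       ∎
        where open ℚ.≤-Reasoning

module Cone where
  open Sums
  open import Data.Nat using (zero; suc)
  open import Data.Fin using (zero; suc)
  open import Data.Rational using (ℚ; 0ℚ; 1ℚ; _+_; _*_; _-_; -_; _≤_; _<_; ∣_∣)
  import Data.Rational.Properties as ℚ
  open import Data.Rational.Solver using (module +-*-Solver)
  open import Data.List using (List; []; _∷_)
  open import Data.List.Membership.Propositional using (_∈_)
  open import Data.List.Relation.Unary.Any using (here; there)
  open import Data.Product using (_,_)
  open import Function using (_∘_)
  open import Relation.Binary.PropositionalEquality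
  open +-*-Solver

  private variable
    N K : ℕ
    x y g : Vect N
    gs hs : List (Vect N)

  InCone-cong : x ≗ y → InCone gs x → InCone gs y
  InCone-cong {gs = []}     x≗y x≡0 i          = trans (sym (x≗y i)) (x≡0 i)
  InCone-cong {gs = g ∷ gs} x≗y (c , 0≤c , rest) = c , 0≤c , InCone-cong (λ i → cong (_- c * g i) (x≗y i)) rest

  InCone-zero : (∀ i → x i ≡ 0ℚ) → InCone gs x
  InCone-zero {gs = []}     x≡0 = x≡0
  InCone-zero {gs = g ∷ gs} x≡0 = 0ℚ , ℚ.≤-refl , InCone-zero (λ i → trans (cong₂ _-_ (x≡0 i) (ℚ.*-zeroˡ (g i))) (ℚ.+-inverseʳ 0ℚ))

  InCone-+ : InCone gs x → InCone gs y → InCone gs (λ i → x i + y i)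
  InCone-+ {gs = []} x≡0 y≡0 i = trans (cong₂ _+_ (x≡0 i) (y≡0 i)) (ℚ.+-identityˡ 0ℚ)
  InCone-+ {gs = g ∷ gs} {x} {y} (c , 0≤c , x′) (d , 0≤d , y′) =
    c + d , nonneg-+ 0≤c 0≤d , InCone-cong regroup (InCone-+ x′ y′)
    where
      regroup : ∀ i → (x i - c * g i) + (y i - d * g i) ≡ (x i + y i) - (c + d) * g i
      regroup i = solve 5 (λ x y c d g → (x :- c :* g) :+ (y :- d :* g) := (x :+ y) :- (c :+ d) :* g) refl (x i) (y i) c d (g i)

  InCone-* : ∀ {a} → 0ℚ ≤ a → InCone gs x → InCone gs (λ i → a * x i)
  InCone-* {gs = []} {a = a} 0≤a x≡0 i = trans (cong (a *_) (x≡0 i)) (ℚ.*-zeroʳ a)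
  InCone-* {gs = g ∷ gs} {x} {a} 0≤a (c , 0≤c , x′) = a * c , nonneg-* 0≤a 0≤c , InCone-cong distrib (InCone-* 0≤a x′)
    where
      distrib : ∀ i → a * (x i - c * g i) ≡ a * x i - a * c * g i
      distrib i = solve 4 (λ a x c g → a :* (x :- c :* g) := a :* x :- a :* c :* g) refl a (x i) c (g i)

  InCone-∈ : g ∈ gs → InCone gs g
  InCone-∈ {g = g} (here refl) = 1ℚ , 0≤1 , InCone-zero (λ i → solve 1 (λ g → g :- con 1ℚ :* g := con 0ℚ) refl (g i))
  InCone-∈ {g = g} {gs = h ∷ gs} (there g∈gs) =
    0ℚ , ℚ.≤-refl , InCone-cong (λ i → solve 2 (λ g h → g := g :- con 0ℚ :* h) refl (g i) (h i)) (InCone-∈ g∈gs)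

  InCone-∑ : (c : Fin K → ℚ) (G : Fin K → Vect N) → (∀ t → 0ℚ ≤ c t) → (∀ t → G t ∈ gs) →
             InCone gs (λ i → sum (λ t → c t * G t i))
  InCone-∑ {zero}  c G _   _    = InCone-zero (λ i → refl)
  InCone-∑ {suc K} c G 0≤c G∈gs = InCone-+ (InCone-* (0≤c zero) (InCone-∈ (G∈gs zero)))
                                            (InCone-∑ (c ∘ suc) (G ∘ suc) (0≤c ∘ suc) (G∈gs ∘ suc))

  InCone-⊆ : (∀ {g} → g ∈ gs → InCone hs g) → InCone gs x → InCone hs x
  InCone-⊆ {gs = []}              _   x≡0               = InCone-zero x≡0
  InCone-⊆ {gs = g ∷ gs} {x = x} gs⊆ (c , 0≤c , x′) =
    InCone-cong (λ i → solve 3 (λ x c g → (x :- c :* g) :+ c :* g := x) refl (x i) c (g i))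
                (InCone-+ (InCone-⊆ (gs⊆ ∘ there) x′) (InCone-* 0≤c (gs⊆ (here refl))))

  ⟪⟫-nonneg-on-cone : ∀ μ → (∀ {g} → g ∈ gs → 0ℚ ≤ ⟪ μ , g ⟫) → InCone gs x → 0ℚ ≤ ⟪ μ , x ⟫
  ⟪⟫-nonneg-on-cone {gs = []}     μ _     x≡0 = ℚ.≤-reflexive (sym (⟪⟫-zero μ x≡0))
  ⟪⟫-nonneg-on-cone {gs = g ∷ gs} {x} μ pos (c , 0≤c , x′) =
    subst (0ℚ ≤_) (solve 2 (λ p q → (p :- q) :+ q := p) refl ⟪ μ , x ⟫ (c * ⟪ μ , g ⟫))
      (nonneg-+ (subst (0ℚ ≤_) (⟪⟫-−* μ x c g) (⟪⟫-nonneg-on-cone μ (pos ∘ there) x′))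
                (nonneg-* 0≤c (pos (here refl))))

  interior-shift : InInterior gs x → g ∈ gs → sumV g ≡ 0ℚ → ∀ {M} → 0ℚ ≤ M →
                   InInterior gs (λ i → x i + M * g i)
  interior-shift {x = x} {g = g} (Σx≡0 , ε , 0<ε , ball) g∈gs Σg≡0 {M} 0≤M =
    shifted-sum , ε , 0<ε , λ y Σy≡0 near →
      InCone-cong (λ i → solve 3 (λ y M g → (y :- M :* g) :+ M :* g := y) refl (y i) M (g i))
        (InCone-+ (ball (λ i → y i - M * g i) (unshifted-sum y Σy≡0) (unshifted-near y near))
                  (InCone-* 0≤M (InCone-∈ g∈gs)))
    where
      ΣMg≡0 : sumV (λ i → M * g i) ≡ 0ℚ
      ΣMg≡0 = trans (sumV-* M g) (trans (cong (M *_) Σg≡0) (ℚ.*-zeroʳ M))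
      shifted-sum : sumV (λ i → x i + M * g i) ≡ 0ℚ
      shifted-sum = trans (sumV-+ x (λ i → M * g i)) (cong₂ _+_ Σx≡0 ΣMg≡0)
      unshifted-sum : ∀ y → sumV y ≡ 0ℚ → sumV (λ i → y i - M * g i) ≡ 0ℚ
      unshifted-sum y Σy≡0 = trans (sumV-− y (λ i → M * g i)) (cong₂ _-_ Σy≡0 ΣMg≡0)
      unshifted-near : ∀ y → (∀ i → ∣ y i - (x i + M * g i) ∣ < ε) → ∀ i → ∣ (y i - M * g i) - x i ∣ < ε
      unshifted-near y near i = subst (λ p → ∣ p ∣ < ε)
        (solve 4 (λ y x M g → y :- (x :+ M :* g) := (y :- M :* g) :- x) refl (y i) (x i) M (g i)) (near i)

  -- With B = count N and x₀ = Σ B G t, a point y = x₀ + d of the unit ball is Σ (B + coeff t d) G t,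
  -- and the coefficients stay nonnegative because each coeff t d ≥ - B there.
  interior-from-basis : (G : Fin K → Vect N) (coeff : Fin K → Vect N → ℚ) →
    (∀ t → G t ∈ gs) → (∀ t → sumV (G t) ≡ 0ℚ) →
    (∀ y → sumV y ≡ 0ℚ → ∀ i → sum (λ t → coeff t y * G t i) ≡ y i) →
    (∀ t d → (∀ k → ∣ d k ∣ < 1ℚ) → - count N ≤ coeff t d) →
    InInterior gs (λ i → sum (λ t → count N * G t i))
  interior-from-basis {K} {N} G coeff G∈gs ΣG≡0 expand coeff-bound =
    Σx₀≡0 , 1ℚ , ℚ.positive⁻¹ 1ℚ , λ y Σy≡0 near →
      InCone-cong (split y Σy≡0) (InCone-∑ (λ t → B + coeff t (d y)) G (nonneg y near) G∈gs)
    where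
      B = count N
      x₀ : Vect N
      x₀ i = sum (λ t → B * G t i)
      d : Vect N → Vect N
      d y i = y i - x₀ i
      Σx₀≡0 : sumV x₀ ≡ 0ℚ
      Σx₀≡0 = begin
        sumV x₀                                   ≡⟨ sumV≡sum x₀ ⟩
        sum (λ i → sum (λ t → B * G t i))         ≡⟨ ∑-comm (λ i t → B * G t i) ⟩
        sum (λ t → sum (λ i → B * G t i))         ≡⟨ sum-cong-≗ (λ t → sym (*-distribˡ-sum B (G t))) ⟩
        sum (λ t → B * sum (G t))                 ≡⟨ ∑-zero (λ t → trans (cong (B *_) (trans (sym (sumV≡sum (G t))) (ΣG≡0 t))) (ℚ.*-zeroʳ B)) ⟩
        0ℚ                                        ∎
        where open ≡-Reasoning
      Σd≡0 : ∀ y → sumV y ≡ 0ℚ → sumV (d y) ≡ 0ℚ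
      Σd≡0 y Σy≡0 = trans (sumV-− y x₀) (cong₂ _-_ Σy≡0 Σx₀≡0)
      split : ∀ y → sumV y ≡ 0ℚ → ∀ i → sum (λ t → (B + coeff t (d y)) * G t i) ≡ y i
      split y Σy≡0 i = begin
        sum (λ t → (B + coeff t (d y)) * G t i)                    ≡⟨ sum-cong-≗ (λ t → ℚ.*-distribʳ-+ (G t i) B (coeff t (d y))) ⟩
        sum (λ t → B * G t i + coeff t (d y) * G t i)              ≡⟨ ∑-distrib-+ (λ t → B * G t i) (λ t → coeff t (d y) * G t i) ⟩
        x₀ i + sum (λ t → coeff t (d y) * G t i)                   ≡⟨ cong (x₀ i +_) (expand (d y) (Σd≡0 y Σy≡0) i) ⟩
        x₀ i + (y i - x₀ i)                                         ≡⟨ solve 2 (λ x y → x :+ (y :- x) := y) refl (x₀ i) (y i) ⟩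
        y i                                                         ∎
        where open ≡-Reasoning
      nonneg : ∀ y → (∀ i → ∣ y i - x₀ i ∣ < 1ℚ) → ∀ t → 0ℚ ≤ B + coeff t (d y)
      nonneg y near t = subst (_≤ B + coeff t (d y)) (ℚ.+-inverseʳ B) (ℚ.+-monoʳ-≤ B (coeff-bound t (d y) near))

module SimpleRootCone {n : ℕ} (w : Permutation′ (suc n)) where
  open Sums
  open Cone
  open import Data.Nat as ℕ using (zero; suc; _<ᵇ_; _<?_)
  import Data.Nat.Properties as ℕ
  open import Data.Fin using (toℕ; zero; suc; inject₁; fromℕ)
  import Data.Fin.Properties as Fin
  open import Data.Fin.Permutation using (_⟨$⟩ʳ_; _⟨$⟩ˡ_; inverseˡ; inverseʳ)
  open import Data.Rational using (ℚ; 0ℚ; 1ℚ; _+_; _*_; _-_; -_; _≤_)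
  import Data.Rational.Properties as ℚ
  open import Data.Rational.Solver using (module +-*-Solver)
  open import Data.Bool using (Bool; true; false; if_then_else_)
  open import Data.List.Membership.Propositional using (_∈_)
  open import Data.List.Membership.Propositional.Properties using (∈-map⁺; ∈-map⁻; ∈-allFin)
  open import Data.Product using (∃; _,_)
  open import Relation.Binary.PropositionalEquality
  open import Relation.Nullary using (Dec; yes; no)
  open import Function using (_∘_)
  open +-*-Solver

  ascent? : Fin n → Bool
  ascent? t = toℕ (w ⟨$⟩ʳ inject₁ t) <ᵇ toℕ (w ⟨$⟩ʳ suc t)

  root : Fin n → Vect (suc n)
  root t = absα (w ⟨$⟩ʳ inject₁ t) (w ⟨$⟩ʳ suc t)

  root∈wSimple : ∀ t → root t ∈ wSimple w
  root∈wSimple t = ∈-map⁺ _ (∈-map⁺ _ (∈-allFin t))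

  ∈wSimple⇒root : ∀ {g} → g ∈ wSimple w → ∃ λ t → g ≡ root t
  ∈wSimple⇒root g∈ with ∈-map⁻ _ g∈
  ... | _ , p∈ , refl with ∈-map⁻ _ p∈
  ...   | t , _ , refl = t , refl

  signed : Bool → ℚ → ℚ
  signed true  q = q
  signed false q = - q

  signed-* : ∀ β p q → signed β p * signed β q ≡ p * q
  signed-* true  p q = refl
  signed-* false p q = solve 2 (λ p q → (:- p) :* (:- q) := p :* q) refl p q

  signed-signed : ∀ β p → signed β (signed β p) ≡ p
  signed-signed true  p = refl
  signed-signed false p = solve 1 (λ p → :- (:- p) := p) refl p

  signed-zero : ∀ β → signed β 0ℚ ≡ 0ℚ
  signed-zero true  = refl
  signed-zero false = refl

  ⟪⟫-signedˡ : ∀ β (μ x : Vect (suc n)) → ⟪ (λ k → signed β (μ k)) , x ⟫ ≡ signed β ⟪ μ , x ⟫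
  ⟪⟫-signedˡ true  μ x = refl
  ⟪⟫-signedˡ false μ x = ⟪⟫-negˡ μ x

  ⟪⟫-signedʳ : ∀ β (μ x : Vect (suc n)) → ⟪ μ , (λ k → signed β (x k)) ⟫ ≡ signed β ⟪ μ , x ⟫
  ⟪⟫-signedʳ β μ x = trans (⟪⟫-comm μ (λ k → signed β (x k))) (trans (⟪⟫-signedˡ β x μ) (cong (signed β) (⟪⟫-comm x μ)))

  root-signed : ∀ t i → root t i ≡ signed (ascent? t) (αF (w ⟨$⟩ʳ inject₁ t) (w ⟨$⟩ʳ suc t) i)
  root-signed t i = by-order (ascent? t)
    where
      a = w ⟨$⟩ʳ inject₁ t
      b = w ⟨$⟩ʳ suc t
      by-order : ∀ β → (if β then αF a b else αF b a) i ≡ signed β (αF a b i)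
      by-order true  = refl
      by-order false = solve 2 (λ p q → q :- p := :- (p :- q)) refl (eF a i) (eF b i)

  before : ℕ → Vect (suc n)
  before j k = 𝟙 (toℕ (w ⟨$⟩ˡ k) <? j)

  coord : Fin n → Vect (suc n)
  coord t k = signed (ascent? t) (before (suc (toℕ t)) k)

  before-w : ∀ j s → before j (w ⟨$⟩ʳ s) ≡ 𝟙 (toℕ s <? j)
  before-w j s = cong (λ p → 𝟙 (toℕ p <? j)) (inverseˡ w)

  before-step : ∀ (s : Fin (suc n)) k → before (suc (toℕ s)) k - before (toℕ s) k ≡ eF (w ⟨$⟩ʳ s) k
  before-step s k with w ⟨$⟩ˡ k Fin.≟ s
  ... | yes refl = begin
    𝟙 (p <? suc p) - 𝟙 (p <? p)       ≡⟨ cong₂ _-_ (𝟙-yes (p <? suc p) (ℕ.n<1+n p)) (𝟙-no (p <? p) (ℕ.n≮n p)) ⟩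
    1ℚ - 0ℚ                           ≡⟨ sym (trans (cong (λ j → eF j k) (inverseʳ w)) (eF-same k)) ⟩
    eF (w ⟨$⟩ʳ (w ⟨$⟩ˡ k)) k          ∎
    where open ≡-Reasoning
          p = toℕ (w ⟨$⟩ˡ k)
  ... | no  k≢ws = begin
    𝟙 (p <? suc (toℕ s)) - 𝟙 (p <? toℕ s)   ≡⟨ cong (_- 𝟙 (p <? toℕ s)) (𝟙-⇔ (p <? suc (toℕ s)) (p <? toℕ s) strict ℕ.m<n⇒m<1+n) ⟩
    𝟙 (p <? toℕ s) - 𝟙 (p <? toℕ s)         ≡⟨ ℚ.+-inverseʳ (𝟙 (p <? toℕ s)) ⟩
    0ℚ                                      ≡⟨ sym (eF-diff (λ ws≡k → k≢ws (trans (cong (w ⟨$⟩ˡ_) (sym ws≡k)) (inverseˡ w)))) ⟩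
    eF (w ⟨$⟩ʳ s) k                         ∎
    where open ≡-Reasoning
          p = toℕ (w ⟨$⟩ˡ k)
          strict : p ℕ.< suc (toℕ s) → p ℕ.< toℕ s
          strict p≤s = ℕ.≤∧≢⇒< (ℕ.s≤s⁻¹ p≤s) (k≢ws ∘ Fin.toℕ-injective)

  before-αF : ∀ (s t : Fin n) → ⟪ before (suc (toℕ s)) , αF (w ⟨$⟩ʳ inject₁ t) (w ⟨$⟩ʳ suc t) ⟫ ≡ eF s t
  before-αF s t = trans (⟪⟫-αF (before (suc (toℕ s))) (w ⟨$⟩ʳ inject₁ t) (w ⟨$⟩ʳ suc t))
                        (trans (cong₂ _-_ (before-w (suc (toℕ s)) (inject₁ t)) (before-w (suc (toℕ s)) (suc t))) (by-cases (t Fin.≟ s)))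
    where
      by-cases : Dec (t ≡ s) → 𝟙 (toℕ (inject₁ t) <? suc (toℕ s)) - 𝟙 (suc (toℕ t) <? suc (toℕ s)) ≡ eF s t
      by-cases (yes refl) = trans (cong₂ _-_ (𝟙-yes (toℕ (inject₁ t) <? suc (toℕ t)) (ℕ.s≤s (ℕ.≤-reflexive (Fin.toℕ-inject₁ t))))
                                               (𝟙-no (suc (toℕ t) <? suc (toℕ t)) (ℕ.n≮n _)))
                                  (sym (eF-same t))
      by-cases (no t≢s)   = trans (cong (_- 𝟙 (suc (toℕ t) <? suc (toℕ s))) (𝟙-⇔ (toℕ (inject₁ t) <? suc (toℕ s)) (suc (toℕ t) <? suc (toℕ s)) strict weak))
                                  (trans (ℚ.+-inverseʳ (𝟙 (suc (toℕ t) <? suc (toℕ s)))) (sym (eF-diff (t≢s ∘ sym))))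
        where
          strict : toℕ (inject₁ t) ℕ.< suc (toℕ s) → suc (toℕ t) ℕ.< suc (toℕ s)
          strict t<1+s = ℕ.s≤s (ℕ.≤∧≢⇒< (subst (ℕ._≤ toℕ s) (Fin.toℕ-inject₁ t) (ℕ.s≤s⁻¹ t<1+s)) (t≢s ∘ Fin.toℕ-injective))
          weak : suc (toℕ t) ℕ.< suc (toℕ s) → toℕ (inject₁ t) ℕ.< suc (toℕ s)
          weak 1+t<1+s = subst (ℕ._< suc (toℕ s)) (sym (Fin.toℕ-inject₁ t)) (ℕ.m<n⇒m<1+n (ℕ.s≤s⁻¹ 1+t<1+s))

  coord-root : ∀ s t → ⟪ coord s , root t ⟫ ≡ signed (ascent? s) (signed (ascent? t) (eF s t))
  coord-root s t = begin
    ⟪ coord s , root t ⟫                                                  ≡⟨ ⟪⟫-signedˡ (ascent? s) (before (suc (toℕ s))) (root t) ⟩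
    signed (ascent? s) ⟪ before (suc (toℕ s)) , root t ⟫                  ≡⟨ cong (signed (ascent? s)) (⟪⟫-cong (before (suc (toℕ s))) (root-signed t)) ⟩
    signed (ascent? s) ⟪ before (suc (toℕ s)) , (λ i → signed (ascent? t) (αF a b i)) ⟫
                                                                          ≡⟨ cong (signed (ascent? s)) (⟪⟫-signedʳ (ascent? t) (before (suc (toℕ s))) (αF a b)) ⟩
    signed (ascent? s) (signed (ascent? t) ⟪ before (suc (toℕ s)) , αF a b ⟫)
                                                                          ≡⟨ cong (λ q → signed (ascent? s) (signed (ascent? t) q)) (before-αF s t) ⟩
    signed (ascent? s) (signed (ascent? t) (eF s t))                      ∎
    where open ≡-Reasoning
          a = w ⟨$⟩ʳ inject₁ t
          b = w ⟨$⟩ʳ suc t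

  coord-root-nonneg : ∀ s t → 0ℚ ≤ ⟪ coord s , root t ⟫
  coord-root-nonneg s t with s Fin.≟ t
  ... | yes refl = ℚ.≤-trans 0≤1 (ℚ.≤-reflexive (sym (trans (coord-root s s) (trans (signed-signed (ascent? s) _) (eF-same s)))))
  ... | no s≢t   = ℚ.≤-reflexive (sym (trans (coord-root s t) (trans (cong (λ q → signed (ascent? s) (signed (ascent? t) q)) (eF-diff s≢t))
                                                                    (trans (cong (signed (ascent? s)) (signed-zero (ascent? t))) (signed-zero (ascent? s))))))

  wSimple-cone⁻ : ∀ {x} → InCone (wSimple w) x → ∀ t → 0ℚ ≤ ⟪ coord t , x ⟫
  wSimple-cone⁻ x∈ t = ⟪⟫-nonneg-on-cone (coord t) root-nonneg x∈
    where
      root-nonneg : ∀ {g} → g ∈ wSimple w → 0ℚ ≤ ⟪ coord t , g ⟫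
      root-nonneg g∈ with ∈wSimple⇒root g∈
      ... | s , refl = coord-root-nonneg t s

  prefix : ℕ → Vect (suc n) → ℚ
  prefix j x = ⟪ before j , x ⟫

  prefix-step : ∀ s x → prefix (suc (toℕ s)) x - prefix (toℕ s) x ≡ x (w ⟨$⟩ʳ s)
  prefix-step s x = begin
    prefix (suc (toℕ s)) x - prefix (toℕ s) x                          ≡⟨ cong₂ _-_ (⟪⟫-comm (before (suc (toℕ s))) x) (trans (⟪⟫-comm (before (toℕ s)) x) (sym (ℚ.*-identityˡ _))) ⟩
    ⟪ x , before (suc (toℕ s)) ⟫ - 1ℚ * ⟪ x , before (toℕ s) ⟫        ≡⟨ sym (⟪⟫-−* x (before (suc (toℕ s))) 1ℚ (before (toℕ s))) ⟩
    ⟪ x , (λ k → before (suc (toℕ s)) k - 1ℚ * before (toℕ s) k) ⟫   ≡⟨ ⟪⟫-cong x (λ k → trans (cong (λ q → before (suc (toℕ s)) k - q) (ℚ.*-identityˡ _)) (before-step s k)) ⟩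
    ⟪ x , eF (w ⟨$⟩ʳ s) ⟫                                              ≡⟨ ⟪⟫-eF x (w ⟨$⟩ʳ s) ⟩
    x (w ⟨$⟩ʳ s)                                                       ∎
    where open ≡-Reasoning

  prefix-none : ∀ x → prefix 0 x ≡ 0ℚ
  prefix-none x = ∑-zero (λ k → trans (cong (_* x k) (𝟙-no (toℕ (w ⟨$⟩ˡ k) <? 0) ℕ.n≮0)) (ℚ.*-zeroˡ (x k)))

  prefix-all : ∀ x → prefix (suc n) x ≡ sumV x
  prefix-all x = trans (⟪⟫-congˡ x (λ k → 𝟙-yes (toℕ (w ⟨$⟩ˡ k) <? suc n) (Fin.toℕ<n _))) (sym (sumV≡⟪1,_⟫ x))

  -- Telescoping in position order; the boundary terms vanish since prefix 0 x = 0 and prefix (suc n) x = Σ x = 0.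
  root-expansion : ∀ {x} → sumV x ≡ 0ℚ → ∀ i → sum (λ t → ⟪ coord t , x ⟫ * root t i) ≡ x i
  root-expansion {x} Σx≡0 i = begin
    sum (λ t → ⟪ coord t , x ⟫ * root t i)                         ≡⟨ sum-cong-≗ unsign ⟩
    sum (λ t → F (inject₁ t) - H (suc t))                           ≡⟨ ∑-sub (F ∘ inject₁) (H ∘ suc) ⟩
    sum (F ∘ inject₁) - sum (H ∘ suc)                               ≡⟨ cong₂ _-_ (sym F-init) (sym H-tail) ⟩
    sum F - sum H                                                   ≡⟨ sym (∑-sub F H) ⟩
    sum (λ s → F s - H s)                                           ≡⟨ sum-cong-≗ step ⟩
    sum (λ s → x (w ⟨$⟩ʳ s) * eF (w ⟨$⟩ʳ s) i)                      ≡⟨ sym (∑-permute (λ k → x k * eF k i) w) ⟩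
    sum (λ k → x k * eF k i)                                        ≡⟨ ⟪⟫-cong x (λ k → eF-sym k i) ⟩
    ⟪ x , eF i ⟫                                                    ≡⟨ ⟪⟫-eF x i ⟩
    x i                                                             ∎
    where
      open ≡-Reasoning
      F H : Fin (suc n) → ℚ
      F s = prefix (suc (toℕ s)) x * eF (w ⟨$⟩ʳ s) i
      H s = prefix (toℕ s) x * eF (w ⟨$⟩ʳ s) i
      unsign : ∀ t → ⟪ coord t , x ⟫ * root t i ≡ F (inject₁ t) - H (suc t)
      unsign t = begin
        ⟪ coord t , x ⟫ * root t i
          ≡⟨ cong₂ _*_ (⟪⟫-signedˡ (ascent? t) (before (suc (toℕ t))) x) (root-signed t i) ⟩
        signed (ascent? t) (prefix (suc (toℕ t)) x) * signed (ascent? t) (αF (w ⟨$⟩ʳ inject₁ t) (w ⟨$⟩ʳ suc t) i)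
          ≡⟨ signed-* (ascent? t) _ _ ⟩
        prefix (suc (toℕ t)) x * (eF (w ⟨$⟩ʳ inject₁ t) i - eF (w ⟨$⟩ʳ suc t) i)
          ≡⟨ solve 3 (λ p a b → p :* (a :- b) := p :* a :- p :* b) refl
                     (prefix (suc (toℕ t)) x) (eF (w ⟨$⟩ʳ inject₁ t) i) (eF (w ⟨$⟩ʳ suc t) i) ⟩
        prefix (suc (toℕ t)) x * eF (w ⟨$⟩ʳ inject₁ t) i - H (suc t)
          ≡⟨ cong (λ j → prefix (suc j) x * eF (w ⟨$⟩ʳ inject₁ t) i - H (suc t)) (sym (Fin.toℕ-inject₁ t)) ⟩
        F (inject₁ t) - H (suc t) ∎
      F-init : sum F ≡ sum (F ∘ inject₁)
      F-init = begin
        sum F                                ≡⟨ sum-init-last F ⟩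
        sum (F ∘ inject₁) + F (fromℕ n)      ≡⟨ cong (sum (F ∘ inject₁) +_) F-last ⟩
        sum (F ∘ inject₁) + 0ℚ               ≡⟨ ℚ.+-identityʳ _ ⟩
        sum (F ∘ inject₁)                    ∎
        where
          F-last : F (fromℕ n) ≡ 0ℚ
          F-last = begin
            prefix (suc (toℕ (fromℕ n))) x * eF ℓ i   ≡⟨ cong (λ j → prefix (suc j) x * eF ℓ i) (Fin.toℕ-fromℕ n) ⟩
            prefix (suc n) x * eF ℓ i                 ≡⟨ cong (_* eF ℓ i) (trans (prefix-all x) Σx≡0) ⟩
            0ℚ * eF ℓ i                               ≡⟨ ℚ.*-zeroˡ (eF ℓ i) ⟩
            0ℚ                                        ∎
            where ℓ = w ⟨$⟩ʳ fromℕ n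
      H-tail : sum H ≡ sum (H ∘ suc)
      H-tail = trans (cong (_+ sum (H ∘ suc)) (trans (cong (_* eF (w ⟨$⟩ʳ zero) i) (prefix-none x))
                                                     (ℚ.*-zeroˡ (eF (w ⟨$⟩ʳ zero) i))))
                     (ℚ.+-identityˡ (sum (H ∘ suc)))
      step : ∀ s → F s - H s ≡ x (w ⟨$⟩ʳ s) * eF (w ⟨$⟩ʳ s) i
      step s = trans (solve 3 (λ p q e → p :* e :- q :* e := (p :- q) :* e) refl
                              (prefix (suc (toℕ s)) x) (prefix (toℕ s) x) (eF (w ⟨$⟩ʳ s) i))
                     (cong (_* eF (w ⟨$⟩ʳ s) i) (prefix-step s x))

  wSimple-cone⁺ : ∀ {x} → sumV x ≡ 0ℚ → (∀ t → 0ℚ ≤ ⟪ coord t , x ⟫) → InCone (wSimple w) x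
  wSimple-cone⁺ {x} Σx≡0 coord-nonneg =
    InCone-cong (root-expansion Σx≡0) (InCone-∑ (λ t → ⟪ coord t , x ⟫) root coord-nonneg root∈wSimple)

module WCharacterisation {n : ℕ} where
  open Sums
  open Cone
  open SimpleRootCone
  open import Data.Nat as ℕ using (zero; suc; _<ᵇ_; _∸_)
  import Data.Nat.Properties as ℕ
  open import Data.Fin using (toℕ; zero; suc; inject₁; opposite)
  import Data.Fin.Properties as Fin
  open import Data.Fin.Permutation using (_⟨$⟩ʳ_; _⟨$⟩ˡ_; _∘ₚ_; reverse)
  import Data.Fin.Permutation as Perm
  open import Data.Rational using (ℚ; 0ℚ; _+_; _*_; _≤_; _<_; ∣_∣)
  import Data.Rational.Properties as ℚ
  open import Data.Bool using (true; false; T; if_then_else_)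
  open import Data.Bool.Properties using (T-≡)
  import Data.List.Properties as List
  open import Data.Empty using (⊥-elim)
  open import Data.List using (List)
  open import Data.List.Membership.Propositional using (_∈_)
  open import Data.Product using (_,_)
  open import Function using (_∘_; mk⇔; Equivalence)
  open import Function.Bundles using (_⇔_)
  open import Relation.Binary.PropositionalEquality

  private variable
    gens : List (Vect (suc n))
    w : Permutation′ (suc n)

  -- (⇒) x₀ + M g is interior for every M ≥ 0, so each coordinate ⟪ coord t , _ ⟫, nonnegative
  -- there, is nonnegative on g.
  W⇔gens⊆cone : ∀ {x₀} → InInterior gens x₀ → (∀ {g} → g ∈ gens → sumV g ≡ 0ℚ) →
                W (suc n) gens w ⇔ (∀ {g} → g ∈ gens → InCone (wSimple w) g)
  W⇔gens⊆cone {gens} {w} {x₀} x₀-interior Σ≡0 = mk⇔ gens⊆cone interior⊆cone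
    where
      interior⊆cone : (∀ {g} → g ∈ gens → InCone (wSimple w) g) → W (suc n) gens w
      interior⊆cone gens⊆ x (Σx≡0 , ε , 0<ε , ball) =
        InCone-⊆ gens⊆ (ball x Σx≡0 (λ i → subst (λ p → ∣ p ∣ < ε) (sym (ℚ.+-inverseʳ (x i))) 0<ε))
      gens⊆cone : W (suc n) gens w → ∀ {g} → g ∈ gens → InCone (wSimple w) g
      gens⊆cone Wh {g} g∈ = wSimple-cone⁺ w (Σ≡0 g∈) (λ t → nonneg-if-shifts-nonneg ⟪ coord w t , x₀ ⟫ ⟪ coord w t , g ⟫ (shifted t))
        where
          shifted : ∀ t M → 0ℚ ≤ M → 0ℚ ≤ ⟪ coord w t , x₀ ⟫ + M * ⟪ coord w t , g ⟫
          shifted t M 0≤M = subst (0ℚ ≤_) (trans (⟪⟫-+ (coord w t) x₀ (λ i → M * g i)) (cong (⟪ coord w t , x₀ ⟫ +_) (⟪⟫-* (coord w t) M g)))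
            (wSimple-cone⁻ w (Wh _ (interior-shift x₀-interior g∈ (Σ≡0 g∈) 0≤M)) t)

  absα-comm : ∀ {a b : Fin (suc n)} → a ≢ b → absα a b ≡ absα b a
  absα-comm {a} {b} a≢b = if-swap (toℕ a <ᵇ toℕ b) (toℕ b <ᵇ toℕ a) asym total
    where
      if-swap : ∀ β γ {p q : Vect (suc n)} → (β ≡ true → γ ≡ false) → (β ≡ false → γ ≡ true) →
                (if β then p else q) ≡ (if γ then q else p)
      if-swap true  γ β⇒¬γ _ rewrite β⇒¬γ refl = refl
      if-swap false γ _ ¬β⇒γ rewrite ¬β⇒γ refl = refl
      asym : (toℕ a <ᵇ toℕ b) ≡ true → (toℕ b <ᵇ toℕ a) ≡ false
      asym a<b with toℕ b <ᵇ toℕ a in b<a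
      ... | false = refl
      ... | true  = ⊥-elim (ℕ.<-asym (ℕ.<ᵇ⇒< (toℕ a) (toℕ b) (Equivalence.from T-≡ a<b)) (ℕ.<ᵇ⇒< (toℕ b) (toℕ a) (Equivalence.from T-≡ b<a)))
      total : (toℕ a <ᵇ toℕ b) ≡ false → (toℕ b <ᵇ toℕ a) ≡ true
      total a≮b = Equivalence.to T-≡ (ℕ.<⇒<ᵇ (ℕ.≤∧≢⇒< (ℕ.≮⇒≥ (λ a<b → subst T a≮b (ℕ.<⇒<ᵇ a<b)))
                                                       (λ b≡a → a≢b (Fin.toℕ-injective (sym b≡a)))))

  opposite-inject₁-opposite : (t : Fin n) → opposite (inject₁ (opposite t)) ≡ suc t
  opposite-inject₁-opposite t = Fin.toℕ-injective (begin
    toℕ (opposite (inject₁ (opposite t)))    ≡⟨ Fin.opposite-prop (inject₁ (opposite t)) ⟩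
    n ∸ toℕ (inject₁ (opposite t))          ≡⟨ cong (n ∸_) (trans (Fin.toℕ-inject₁ (opposite t)) (Fin.opposite-prop t)) ⟩
    n ∸ (n ∸ suc (toℕ t))                   ≡⟨ ℕ.m∸[m∸n]≡n (Fin.toℕ<n t) ⟩
    suc (toℕ t)                             ∎)
    where open ≡-Reasoning

  opposite-suc-opposite : (t : Fin n) → opposite (suc (opposite t)) ≡ inject₁ t
  opposite-suc-opposite t = Fin.toℕ-injective (begin
    toℕ (opposite (suc (opposite t)))    ≡⟨ Fin.opposite-prop (suc (opposite t)) ⟩
    n ∸ suc (toℕ (opposite t))          ≡⟨ cong (λ k → n ∸ suc k) (Fin.opposite-prop t) ⟩
    n ∸ suc (n ∸ suc (toℕ t))           ≡⟨ cong (n ∸_) (sym (ℕ.+-∸-assoc 1 (Fin.toℕ<n t))) ⟩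
    n ∸ (n ∸ toℕ t)                     ≡⟨ ℕ.m∸[m∸n]≡n (ℕ.<⇒≤ (Fin.toℕ<n t)) ⟩
    toℕ t                               ≡⟨ sym (Fin.toℕ-inject₁ t) ⟩
    toℕ (inject₁ t)                     ∎)
    where open ≡-Reasoning

  -- The t-th vector of w ∘ w₀ is the (n-1-t)-th vector of w.
  wSimple-reverse : ∀ {g} → g ∈ wSimple w → g ∈ wSimple (reverse ∘ₚ w)
  wSimple-reverse {w} g∈ with ∈wSimple⇒root w g∈
  ... | t , refl = subst (_∈ wSimple (reverse ∘ₚ w)) reversed-root (root∈wSimple (reverse ∘ₚ w) (opposite t))
    where
      suc≢inject₁ : suc t ≢ inject₁ t
      suc≢inject₁ eq = ℕ.1+n≢n (trans (cong toℕ eq) (Fin.toℕ-inject₁ t))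
      reversed-root : root (reverse ∘ₚ w) (opposite t) ≡ root w t
      reversed-root = trans (cong₂ (λ i j → absα (w ⟨$⟩ʳ i) (w ⟨$⟩ʳ j)) (opposite-inject₁-opposite t) (opposite-suc-opposite t))
                            (absα-comm (λ eq → suc≢inject₁ (trans (sym (Perm.inverseˡ w)) (trans (cong (w ⟨$⟩ˡ_) eq) (Perm.inverseˡ w)))))

  W-reverse : W (suc n) gens w → W (suc n) gens (reverse ∘ₚ w)
  W-reverse {w = w} Wh x x-interior = InCone-⊆ (InCone-∈ ∘ wSimple-reverse {w}) (Wh x x-interior)

  W-cong : ∀ {w′} → (∀ i → w ⟨$⟩ʳ i ≡ w′ ⟨$⟩ʳ i) → W (suc n) gens w → W (suc n) gens w′
  W-cong {w = w} {gens = gens} {w′} w≗w′ Wh x x-interior =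
    subst (λ gs → InCone gs x) (List.map-cong (λ { (i , j) → cong₂ absα (w≗w′ i) (w≗w′ j) }) (consec (suc n))) (Wh x x-interior)

module DoubleStar {n : ℕ} (f : ℕ) (1≤f : 1 ℕ.≤ f) (f≤n : f ℕ.≤ n) where
  open Sums
  open Cone
  open import Data.Nat as ℕ using (zero; suc; _<?_)
  import Data.Nat.Properties as ℕ
  open import Data.Fin using (toℕ; zero; suc; fromℕ)
  import Data.Fin.Properties as Fin
  open import Data.Rational using (ℚ; 0ℚ; 1ℚ; _+_; _*_; _-_; -_; _≤_; _<_; ∣_∣)
  import Data.Rational.Properties as ℚ
  open import Data.Rational.Solver using (module +-*-Solver)
  open import Relation.Binary.PropositionalEquality
  open import Relation.Nullary using (yes; no)
  open import Data.List.Membership.Propositional using (_∈_)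
  open import Function using (_∘_; mk⇔; Equivalence)
  open import Function.Bundles using (_⇔_)
  open WCharacterisation {n}
  open +-*-Solver

  -- Vertex a stands for e_{a+1}.  The centre carries a dummy copy of the edge 0–n with
  -- coefficient 0, so that the edges are indexed by all vertices.

  last : Fin (suc n)
  last = fromℕ n

  data Vertex (a : Fin (suc n)) : Set where
    centre : a ≡ zero → Vertex a
    left   : 1 ℕ.≤ toℕ a → toℕ a ℕ.< f → Vertex a
    right  : f ℕ.≤ toℕ a → toℕ a ℕ.< n → Vertex a
    top    : a ≡ last → Vertex a

  vertex : ∀ a → Vertex a
  vertex a with toℕ a ℕ.≟ 0 | toℕ a <? f | toℕ a <? n
  ... | yes a≡0 | _       | _       = centre (Fin.toℕ-injective a≡0)
  ... | no  a≢0 | yes a<f | _       = left (ℕ.n≢0⇒n>0 a≢0) a<f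
  ... | no  _   | no  a≮f | yes a<n = right (ℕ.≮⇒≥ a≮f) a<n
  ... | no  _   | no  _   | no  a≮n = top (Fin.toℕ-injective (trans (ℕ.≤-antisym (Fin.toℕ≤pred[n] a) (ℕ.≮⇒≥ a≮n))
                                                                  (sym (Fin.toℕ-fromℕ n))))

  zero≢last : zero ≢ last
  zero≢last eq = ℕ.<-irrefl (trans (cong toℕ eq) (Fin.toℕ-fromℕ n)) (ℕ.<-≤-trans 1≤f f≤n)

  below-last : ∀ {a} → toℕ a ℕ.< n → a ≢ last
  below-last a<n a≡last = ℕ.<-irrefl (trans (cong toℕ a≡last) (Fin.toℕ-fromℕ n)) a<n

  edge : Fin (suc n) → Vect (suc n)
  edge a with vertex a
  ... | centre _  = αF zero last
  ... | left _ _  = αF zero a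
  ... | right _ _ = αF a last
  ... | top _     = αF zero last

  leftCoeff rightCoeff : Fin (suc n) → Vect (suc n) → ℚ
  leftCoeff a y with vertex a
  ... | left _ _ = - y a
  ... | _        = 0ℚ
  rightCoeff a y with vertex a
  ... | right _ _ = y a
  ... | _         = 0ℚ

  initial : Vect (suc n)
  initial a = 𝟙 (toℕ a <? f)

  coeff : Fin (suc n) → Vect (suc n) → ℚ
  coeff a y with vertex a
  ... | centre _  = 0ℚ
  ... | left _ _  = - y a
  ... | right _ _ = y a
  ... | top _     = ⟪ initial , y ⟫

  coeff-split : ∀ a y i → coeff a y * edge a i ≡
                leftCoeff a y * αF zero a i + (rightCoeff a y * αF a last i + eF last a * (⟪ initial , y ⟫ * αF zero last i))
  coeff-split a y i with vertex a
  ... | centre refl   = trans (solve 3 (λ p q r → con 0ℚ :* p := con 0ℚ :* q :+ (con 0ℚ :* p :+ con 0ℚ :* r)) refl P Q ER)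
                              (cong (λ c → 0ℚ * Q + (0ℚ * P + c * ER)) (sym (eF-diff (zero≢last ∘ sym))))
    where P = αF zero last i; Q = αF zero zero i; ER = ⟪ initial , y ⟫ * αF zero last i
  ... | left 1≤a a<f  = trans (solve 3 (λ p q r → p := p :+ (con 0ℚ :* q :+ con 0ℚ :* r)) refl (- y a * Q) S ER)
                              (cong (λ c → - y a * Q + (0ℚ * S + c * ER)) (sym (eF-diff (below-last (ℕ.<-≤-trans a<f f≤n) ∘ sym))))
    where Q = αF zero a i; S = αF a last i; ER = ⟪ initial , y ⟫ * αF zero last i
  ... | right f≤a a<n = trans (solve 3 (λ p q r → p := con 0ℚ :* q :+ (p :+ con 0ℚ :* r)) refl (y a * S) Q ER)
                              (cong (λ c → 0ℚ * Q + (y a * S + c * ER)) (sym (eF-diff (below-last a<n ∘ sym))))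
    where Q = αF zero a i; S = αF a last i; ER = ⟪ initial , y ⟫ * αF zero last i
  ... | top refl      = trans (solve 3 (λ p q r → p := con 0ℚ :* q :+ (con 0ℚ :* r :+ con 1ℚ :* p)) refl ER Q S)
                              (cong (λ c → 0ℚ * Q + (0ℚ * S + c * ER)) (sym (eF-same last)))
    where Q = αF zero last i; S = αF last last i; ER = ⟪ initial , y ⟫ * αF zero last i

  leftCoeff+initial : ∀ a y → leftCoeff a y + initial a * y a ≡ eF zero a * y a
  leftCoeff+initial a y with vertex a
  ... | centre refl   = trans (cong (λ c → 0ℚ + c * y zero) (𝟙-yes (0 <? f) 1≤f))
                              (solve 1 (λ q → con 0ℚ :+ con 1ℚ :* q := con 1ℚ :* q) refl (y zero))
  ... | left 1≤a a<f  = trans (cong (λ c → - y a + c * y a) (𝟙-yes (toℕ a <? f) a<f))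
                              (trans (solve 1 (λ q → :- q :+ con 1ℚ :* q := con 0ℚ :* q) refl (y a))
                                     (cong (_* y a) (sym (eF-diff (λ 0≡a → ℕ.<-irrefl (cong toℕ 0≡a) 1≤a)))))
  ... | right f≤a a<n = trans (cong (λ c → 0ℚ + c * y a) (𝟙-no (toℕ a <? f) (ℕ.≤⇒≯ f≤a)))
                              (trans (solve 1 (λ q → con 0ℚ :+ con 0ℚ :* q := con 0ℚ :* q) refl (y a))
                                     (cong (_* y a) (sym (eF-diff (λ 0≡a → ℕ.<-irrefl (cong toℕ 0≡a) (ℕ.<-≤-trans 1≤f f≤a))))))
  ... | top refl      = trans (cong (λ c → 0ℚ + c * y last) (𝟙-no (toℕ last <? f) (ℕ.≤⇒≯ (subst (f ℕ.≤_) (sym (Fin.toℕ-fromℕ n)) f≤n))))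
                              (trans (solve 1 (λ q → con 0ℚ :+ con 0ℚ :* q := con 0ℚ :* q) refl (y last))
                                     (cong (_* y last) (sym (eF-diff zero≢last))))

  rightCoeff+initial+last : ∀ a y → rightCoeff a y + initial a * y a + eF last a * y a ≡ y a
  rightCoeff+initial+last a y with vertex a
  ... | centre refl   = trans (cong₂ (λ c d → 0ℚ + c * y zero + d * y zero) (𝟙-yes (0 <? f) 1≤f) (eF-diff (zero≢last ∘ sym)))
                              (solve 1 (λ q → con 0ℚ :+ con 1ℚ :* q :+ con 0ℚ :* q := q) refl (y zero))
  ... | left 1≤a a<f  = trans (cong₂ (λ c d → 0ℚ + c * y a + d * y a) (𝟙-yes (toℕ a <? f) a<f) (eF-diff (below-last (ℕ.<-≤-trans a<f f≤n) ∘ sym)))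
                              (solve 1 (λ q → con 0ℚ :+ con 1ℚ :* q :+ con 0ℚ :* q := q) refl (y a))
  ... | right f≤a a<n = trans (cong₂ (λ c d → y a + c * y a + d * y a) (𝟙-no (toℕ a <? f) (ℕ.≤⇒≯ f≤a)) (eF-diff (below-last a<n ∘ sym)))
                              (solve 1 (λ q → q :+ con 0ℚ :* q :+ con 0ℚ :* q := q) refl (y a))
  ... | top refl      = trans (cong₂ (λ c d → 0ℚ + c * y last + d * y last)
                                     (𝟙-no (toℕ last <? f) (ℕ.≤⇒≯ (subst (f ℕ.≤_) (sym (Fin.toℕ-fromℕ n)) f≤n))) (eF-same last))
                              (solve 1 (λ q → con 0ℚ :+ con 0ℚ :* q :+ con 1ℚ :* q := q) refl (y last))

  centre-balance : ∀ y → sum (λ a → leftCoeff a y) + ⟪ initial , y ⟫ ≡ y zero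
  centre-balance y = begin
    sum (λ a → leftCoeff a y) + ⟪ initial , y ⟫             ≡⟨ sym (∑-distrib-+ (λ a → leftCoeff a y) (λ a → initial a * y a)) ⟩
    sum (λ a → leftCoeff a y + initial a * y a)             ≡⟨ sum-cong-≗ (λ a → leftCoeff+initial a y) ⟩
    sum (λ a → eF zero a * y a)                             ≡⟨ trans (⟪⟫-comm (eF zero) y) (⟪⟫-eF y zero) ⟩
    y zero                                                  ∎
    where open ≡-Reasoning

  top-balance : ∀ y → sumV y ≡ 0ℚ → sum (λ a → rightCoeff a y) + ⟪ initial , y ⟫ + y last ≡ 0ℚ
  top-balance y Σy≡0 = begin
    sum R + ⟪ initial , y ⟫ + y last                         ≡⟨ cong (sum R + ⟪ initial , y ⟫ +_) (sym (trans (⟪⟫-comm (eF last) y) (⟪⟫-eF y last))) ⟩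
    sum R + sum (λ a → initial a * y a) + sum (λ a → eF last a * y a)
                                                            ≡⟨ cong (_+ sum (λ a → eF last a * y a)) (sym (∑-distrib-+ R (λ a → initial a * y a))) ⟩
    sum (λ a → R a + initial a * y a) + sum (λ a → eF last a * y a)
                                                            ≡⟨ sym (∑-distrib-+ (λ a → R a + initial a * y a) (λ a → eF last a * y a)) ⟩
    sum (λ a → R a + initial a * y a + eF last a * y a)     ≡⟨ sum-cong-≗ (λ a → rightCoeff+initial+last a y) ⟩
    sum y                                                   ≡⟨ trans (sym (sumV≡sum y)) Σy≡0 ⟩
    0ℚ                                                      ∎
    where
      open ≡-Reasoning
      R = λ a → rightCoeff a y

  edge-expansion : ∀ {y} → sumV y ≡ 0ℚ → ∀ i → sum (λ a → coeff a y * edge a i) ≡ y i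
  edge-expansion {y} Σy≡0 i = begin
    sum (λ a → coeff a y * edge a i)
      ≡⟨ sum-cong-≗ (λ a → coeff-split a y i) ⟩
    sum (λ a → L a * αF zero a i + (R a * αF a last i + eF last a * (E * αF zero last i)))
      ≡⟨ ∑-distrib-+ (λ a → L a * αF zero a i) (λ a → R a * αF a last i + eF last a * (E * αF zero last i)) ⟩
    sum (λ a → L a * αF zero a i) + sum (λ a → R a * αF a last i + eF last a * (E * αF zero last i))
      ≡⟨ cong (sum (λ a → L a * αF zero a i) +_) (∑-distrib-+ (λ a → R a * αF a last i) (λ a → eF last a * (E * αF zero last i))) ⟩
    sum (λ a → L a * αF zero a i) + (sum (λ a → R a * αF a last i) + sum (λ a → eF last a * (E * αF zero last i)))
      ≡⟨ cong₂ _+_ (∑-star-out L zero i) (cong₂ _+_ (∑-star-in R last i) (∑-eF* last (E * αF zero last i))) ⟩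
    Φ (eF zero i) (eF last i) (L i) (R i)
      ≡⟨ at-vertex i ⟩
    y i ∎
    where
      open ≡-Reasoning
      L R : Vect (suc n)
      L a = leftCoeff a y
      R a = rightCoeff a y
      E = ⟪ initial , y ⟫
      Φ : ℚ → ℚ → ℚ → ℚ → ℚ
      Φ e₀ eₙ l r = (sum L * e₀ - l) + ((r - sum R * eₙ) + E * (e₀ - eₙ))
      at-vertex : ∀ i → Φ (eF zero i) (eF last i) (L i) (R i) ≡ y i
      at-vertex i with vertex i
      ... | centre refl = begin
        Φ 1ℚ (eF last zero) 0ℚ 0ℚ              ≡⟨ cong (λ eₙ → Φ 1ℚ eₙ 0ℚ 0ℚ) (eF-diff (zero≢last ∘ sym)) ⟩
        Φ 1ℚ 0ℚ 0ℚ 0ℚ                          ≡⟨ solve 3 (λ l r e → (l :* con 1ℚ :- con 0ℚ) :+ ((con 0ℚ :- r :* con 0ℚ) :+ e :* (con 1ℚ :- con 0ℚ)) := l :+ e) refl (sum L) (sum R) E ⟩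
        sum L + E                               ≡⟨ centre-balance y ⟩
        y zero                                  ∎
      ... | left 1≤i i<f = begin
        Φ (eF zero i) (eF last i) (- y i) 0ℚ   ≡⟨ cong₂ (λ e₀ eₙ → Φ e₀ eₙ (- y i) 0ℚ) (eF-diff (λ 0≡i → ℕ.<-irrefl (cong toℕ 0≡i) 1≤i))
                                                                                 (eF-diff (below-last (ℕ.<-≤-trans i<f f≤n) ∘ sym)) ⟩
        Φ 0ℚ 0ℚ (- y i) 0ℚ                     ≡⟨ solve 4 (λ l r e q → (l :* con 0ℚ :- (:- q)) :+ ((con 0ℚ :- r :* con 0ℚ) :+ e :* (con 0ℚ :- con 0ℚ)) := q) refl (sum L) (sum R) E (y i) ⟩
        y i                                    ∎
      ... | right f≤i i<n = begin
        Φ (eF zero i) (eF last i) 0ℚ (y i)     ≡⟨ cong₂ (λ e₀ eₙ → Φ e₀ eₙ 0ℚ (y i)) (eF-diff (λ 0≡i → ℕ.<-irrefl (cong toℕ 0≡i) (ℕ.<-≤-trans 1≤f f≤i)))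
                                                                                (eF-diff (below-last i<n ∘ sym)) ⟩
        Φ 0ℚ 0ℚ 0ℚ (y i)                       ≡⟨ solve 4 (λ l r e q → (l :* con 0ℚ :- con 0ℚ) :+ ((q :- r :* con 0ℚ) :+ e :* (con 0ℚ :- con 0ℚ)) := q) refl (sum L) (sum R) E (y i) ⟩
        y i                                    ∎
      ... | top refl = begin
        Φ (eF zero last) (eF last last) 0ℚ 0ℚ  ≡⟨ cong₂ (λ e₀ eₙ → Φ e₀ eₙ 0ℚ 0ℚ) (eF-diff zero≢last) (eF-same last) ⟩
        Φ 0ℚ 1ℚ 0ℚ 0ℚ                          ≡⟨ solve 4 (λ l r e q → (l :* con 0ℚ :- con 0ℚ) :+ ((con 0ℚ :- r :* con 1ℚ) :+ e :* (con 0ℚ :- con 1ℚ))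
                                                                   := q :- (r :+ e :+ q)) refl (sum L) (sum R) E (y last) ⟩
        y last - (sum R + E + y last)          ≡⟨ cong (λ s → y last - s) (top-balance y Σy≡0) ⟩
        y last - 0ℚ                           ≡⟨ solve 1 (λ q → q :- con 0ℚ := q) refl (y last) ⟩
        y last                                 ∎

  coeff-bound : ∀ a d → (∀ k → ∣ d k ∣ < 1ℚ) → - count (suc n) ≤ coeff a d
  coeff-bound a d near with vertex a
  ... | centre _  = ℚ.neg-antimono-≤ (count-nonneg (suc n))
  ... | left _ _  = subst (- count (suc n) ≤_) (trans (⟪⟫-negˡ (eF a) d) (cong -_ (trans (⟪⟫-comm (eF a) d) (⟪⟫-eF d a))))
                      (⟪⟫-lower-bound (λ k → - eF a k) d (λ k → subst (_≤ 1ℚ) (sym (ℚ.∣-p∣≡∣p∣ (eF a k))) (∣𝟙∣≤1 (suc (toℕ k) ℕ.≟ suc (toℕ a)))) near)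
  ... | right _ _ = subst (- count (suc n) ≤_) (trans (⟪⟫-comm (eF a) d) (⟪⟫-eF d a))
                      (⟪⟫-lower-bound (eF a) d (λ k → ∣𝟙∣≤1 (suc (toℕ k) ℕ.≟ suc (toℕ a))) near)
  ... | top _     = ⟪⟫-lower-bound initial d (λ k → ∣𝟙∣≤1 (toℕ k <? f)) near

  data Edge : Vect (suc n) → Set where
    inner  : ∀ {a} → 1 ℕ.≤ toℕ a → toℕ a ℕ.< f → Edge (αF zero a)
    outer  : ∀ {a} → f ℕ.≤ toℕ a → toℕ a ℕ.< n → Edge (αF a last)
    bridge : Edge (αF zero last)

  edge-Edge : ∀ a → Edge (edge a)
  edge-Edge a with vertex a
  ... | centre _      = bridge
  ... | left 1≤a a<f  = inner 1≤a a<f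
  ... | right f≤a a<n = outer f≤a a<n
  ... | top _         = bridge

  Edge-sum : ∀ {g} → Edge g → sumV g ≡ 0ℚ
  Edge-sum (inner {a} _ _) = sumV-αF zero a
  Edge-sum (outer {a} _ _) = sumV-αF a last
  Edge-sum bridge          = sumV-αF zero last

  W⇔Edges⊆cone : ∀ {gens w} → (∀ {g} → Edge g → g ∈ gens) → (∀ {g} → g ∈ gens → Edge g) →
                 W (suc n) gens w ⇔ (∀ {g} → Edge g → InCone (wSimple w) g)
  W⇔Edges⊆cone {gens} {w} Edge⊆gens gens⊆Edge =
    mk⇔ (λ Wh {g} g-edge → Equivalence.to W⇔ Wh (Edge⊆gens g-edge)) (λ edges⊆ → Equivalence.from W⇔ (λ {g} g∈ → edges⊆ (gens⊆Edge g∈)))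
    where
      interior : InInterior gens (λ i → sum (λ a → count (suc n) * edge a i))
      interior = interior-from-basis edge coeff (Edge⊆gens ∘ edge-Edge) (Edge-sum ∘ edge-Edge) (λ y Σy≡0 → edge-expansion Σy≡0) coeff-bound
      W⇔ = W⇔gens⊆cone {gens = gens} {w = w} interior (Edge-sum ∘ gens⊆Edge)

module Positions where
  open import Data.Nat as ℕ using (suc; _≤_; _<_; _<?_; _∸_)
  import Data.Nat.Properties as ℕ
  open import Data.Fin using (toℕ; fromℕ<; opposite)
  import Data.Fin.Properties as Fin
  open import Data.Fin.Permutation using (_⟨$⟩ʳ_; _⟨$⟩ˡ_; inverseˡ; flip; reverse; _∘ₚ_)
  open import Data.Product using (_×_)
  open import Data.Sum using (inj₁; inj₂)
  open import Data.Empty using (⊥-elim)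
  open import Relation.Binary.PropositionalEquality
  open import Relation.Nullary using (¬_; yes; no)

  private variable
    N : ℕ
    s t : ℕ

  infix 20 _⟦_⟧ _⟦_⟧⁻¹

  -- Value at a position, and (below) position of a value; arguments ≥ N give the junk value 0.
  _⟦_⟧ : Permutation′ N → ℕ → ℕ
  _⟦_⟧ {N} w t with t <? N
  ... | yes t<N = toℕ (w ⟨$⟩ʳ fromℕ< t<N)
  ... | no  _   = 0

  _⟦_⟧⁻¹ : Permutation′ N → ℕ → ℕ
  w ⟦ v ⟧⁻¹ = flip w ⟦ v ⟧

  ⟦⟧-fromℕ< : ∀ (w : Permutation′ N) → (t<N : t < N) → w ⟦ t ⟧ ≡ toℕ (w ⟨$⟩ʳ fromℕ< t<N)
  ⟦⟧-fromℕ< {N} {t} w t<N with t <? N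
  ... | yes _   = refl
  ... | no  t≮N = ⊥-elim (t≮N t<N)

  ⟦toℕ⟧ : ∀ (w : Permutation′ N) i → w ⟦ toℕ i ⟧ ≡ toℕ (w ⟨$⟩ʳ i)
  ⟦toℕ⟧ w i = trans (⟦⟧-fromℕ< w (Fin.toℕ<n i)) (cong (λ j → toℕ (w ⟨$⟩ʳ j)) (Fin.fromℕ<-toℕ i _))

  ⟦⟧<N : ∀ (w : Permutation′ N) → t < N → w ⟦ t ⟧ < N
  ⟦⟧<N w t<N = subst (_< _) (sym (⟦⟧-fromℕ< w t<N)) (Fin.toℕ<n _)

  ⟦⟦⟧⟧⁻¹ : ∀ (w : Permutation′ N) → t < N → w ⟦ w ⟦ t ⟧ ⟧⁻¹ ≡ t
  ⟦⟦⟧⟧⁻¹ w t<N = begin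
    w ⟦ w ⟦ _ ⟧ ⟧⁻¹                       ≡⟨ cong (w ⟦_⟧⁻¹) (⟦⟧-fromℕ< w t<N) ⟩
    flip w ⟦ toℕ (w ⟨$⟩ʳ fromℕ< t<N) ⟧   ≡⟨ ⟦toℕ⟧ (flip w) (w ⟨$⟩ʳ fromℕ< t<N) ⟩
    toℕ (w ⟨$⟩ˡ (w ⟨$⟩ʳ fromℕ< t<N))     ≡⟨ cong toℕ (inverseˡ w) ⟩
    toℕ (fromℕ< t<N)                     ≡⟨ Fin.toℕ-fromℕ< t<N ⟩
    _                                    ∎
    where open ≡-Reasoning

  ⟦⟦⟧⁻¹⟧ : ∀ (w : Permutation′ N) → t < N → w ⟦ w ⟦ t ⟧⁻¹ ⟧ ≡ t
  ⟦⟦⟧⁻¹⟧ w = ⟦⟦⟧⟧⁻¹ (flip w)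

  ⟦⟧⁻¹<N : ∀ (w : Permutation′ N) → t < N → w ⟦ t ⟧⁻¹ < N
  ⟦⟧⁻¹<N w = ⟦⟧<N (flip w)

  ⟦⟧-injective : ∀ (w : Permutation′ N) → s < N → t < N → w ⟦ s ⟧ ≡ w ⟦ t ⟧ → s ≡ t
  ⟦⟧-injective w s<N t<N eq = trans (sym (⟦⟦⟧⟧⁻¹ w s<N)) (trans (cong (w ⟦_⟧⁻¹) eq) (⟦⟦⟧⟧⁻¹ w t<N))

  ⟦⟧⁻¹-injective : ∀ (w : Permutation′ N) → s < N → t < N → w ⟦ s ⟧⁻¹ ≡ w ⟦ t ⟧⁻¹ → s ≡ t
  ⟦⟧⁻¹-injective w = ⟦⟧-injective (flip w)

  reverse-position : ∀ (w : Permutation′ N) {a} → a < N → (reverse ∘ₚ w) ⟦ a ⟧⁻¹ ≡ N ∸ suc (w ⟦ a ⟧⁻¹)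
  reverse-position {N} w a<N = begin
    (reverse ∘ₚ w) ⟦ _ ⟧⁻¹                       ≡⟨ ⟦⟧-fromℕ< (flip (reverse ∘ₚ w)) a<N ⟩
    toℕ (opposite (w ⟨$⟩ˡ fromℕ< a<N))          ≡⟨ Fin.opposite-prop (w ⟨$⟩ˡ fromℕ< a<N) ⟩
    N ∸ suc (toℕ (w ⟨$⟩ˡ fromℕ< a<N))           ≡⟨ cong (λ p → N ∸ suc p) (sym (⟦⟧-fromℕ< (flip w) a<N)) ⟩
    N ∸ suc (w ⟦ _ ⟧⁻¹)                         ∎
    where open ≡-Reasoning

  Ascent : Permutation′ N → ℕ → Set
  Ascent w t = w ⟦ t ⟧ < w ⟦ suc t ⟧

  Ascends : Permutation′ N → ℕ → ℕ → Set
  Ascends w a c = ∀ t → (w ⟦ a ⟧⁻¹ ≤ t → t < w ⟦ c ⟧⁻¹ → Ascent w t)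
                      × (w ⟦ c ⟧⁻¹ ≤ t → t < w ⟦ a ⟧⁻¹ → ¬ Ascent w t)

  DoubleStarCond : Permutation′ N → (f top : ℕ) → Set
  DoubleStarCond w f top = (∀ a → 1 ≤ a → a < f → Ascends w 0 a)
                         × (∀ a → f ≤ a → a < top → Ascends w a top)
                         × Ascends w 0 top

  StarCond : Permutation′ N → Set
  StarCond {N} u = ∀ a → 0 < a → a < N → Ascends u 0 a

  TopCond : Permutation′ N → ℕ → Set
  TopCond v c = ∀ a → a < c → Ascends v a c

  ascending-run : ∀ (w : Permutation′ N) {p q} → (∀ t → p ≤ t → t < q → Ascent w t) → p < q → w ⟦ p ⟧ < w ⟦ q ⟧
  ascending-run w {p} {suc q} run p<1+q with ℕ.m≤n⇒m<n∨m≡n (ℕ.s≤s⁻¹ p<1+q)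
  ... | inj₁ p<q  = ℕ.<-trans (ascending-run w (λ t p≤t t<q → run t p≤t (ℕ.m<n⇒m<1+n t<q)) p<q) (run q (ℕ.<⇒≤ p<q) ℕ.≤-refl)
  ... | inj₂ refl = run p ℕ.≤-refl ℕ.≤-refl

module RootInCone {n : ℕ} (w : Permutation′ (suc n)) where
  open Sums
  open Cone
  open SimpleRootCone w
  open Positions
  open import Data.Nat as ℕ using (suc; _<?_; _<ᵇ_)
  import Data.Nat.Properties as ℕ
  open import Data.Fin using (toℕ; inject₁; fromℕ<)
  import Data.Fin.Properties as Fin
  open import Data.Fin.Permutation using (_⟨$⟩ʳ_; flip)
  open import Data.Rational using (ℚ; 0ℚ; 1ℚ; _-_; -_; _≤_)
  import Data.Rational.Properties as ℚ
  open import Data.Bool using (Bool; true; false)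
  open import Data.Bool.Properties using (T-≡)
  open import Data.Product using (_,_; proj₁; proj₂)
  open import Data.Empty using (⊥-elim)
  open import Function using (_∘_; mk⇔; Equivalence)
  open import Function.Bundles using (_⇔_)
  open import Relation.Binary.PropositionalEquality
  open import Relation.Nullary using (Dec; yes; no; ¬_)

  ascent?≡true⇔ : ∀ t → ascent? t ≡ true ⇔ Ascent w (toℕ t)
  ascent?≡true⇔ t = mk⇔ (λ asc → subst₂ ℕ._<_ (sym value-at-t) (sym (⟦toℕ⟧ w (Fin.suc t))) (ℕ.<ᵇ⇒< _ _ (Equivalence.from T-≡ asc)))
                        (λ asc → Equivalence.to T-≡ (ℕ.<⇒<ᵇ (subst₂ ℕ._<_ value-at-t (⟦toℕ⟧ w (Fin.suc t)) asc)))
    where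
      value-at-t : w ⟦ toℕ t ⟧ ≡ toℕ (w ⟨$⟩ʳ inject₁ t)
      value-at-t = trans (cong (w ⟦_⟧) (sym (Fin.toℕ-inject₁ t))) (⟦toℕ⟧ w (inject₁ t))

  coord-αF : ∀ t a c → ⟪ coord t , αF a c ⟫ ≡
             signed (ascent? t) (𝟙 (w ⟦ toℕ a ⟧⁻¹ <? suc (toℕ t)) - 𝟙 (w ⟦ toℕ c ⟧⁻¹ <? suc (toℕ t)))
  coord-αF t a c = trans (⟪⟫-signedˡ (ascent? t) (before (suc (toℕ t))) (αF a c))
                         (cong (signed (ascent? t)) (trans (⟪⟫-αF (before (suc (toℕ t))) a c)
                           (cong₂ (λ p q → 𝟙 (p <? suc (toℕ t)) - 𝟙 (q <? suc (toℕ t))) (sym (⟦toℕ⟧ (flip w) a)) (sym (⟦toℕ⟧ (flip w) c)))))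

  -1≱0 : ¬ (0ℚ ≤ - 1ℚ)
  -1≱0 0≤-1 = ℚ.<-irrefl refl (ℚ.≤-<-trans 0≤-1 (ℚ.negative⁻¹ (- 1ℚ)))

  module _ (a c : Fin (suc n)) where
    private
      pa = w ⟦ toℕ a ⟧⁻¹
      pc = w ⟦ toℕ c ⟧⁻¹

    cone⇒Ascends : InCone (wSimple w) (αF a c) → Ascends w (toℕ a) (toℕ c)
    cone⇒Ascends αF∈ t = rising , falling
      where
        rising : pa ℕ.≤ t → t ℕ.< pc → Ascent w t
        rising pa≤t t<pc = subst (Ascent w) (Fin.toℕ-fromℕ< t<n) (Equivalence.to (ascent?≡true⇔ tf) (forced (ascent? tf) refl))
          where
            t<n = ℕ.<-≤-trans t<pc (ℕ.s≤s⁻¹ (⟦⟧⁻¹<N w (Fin.toℕ<n c)))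
            tf = fromℕ< t<n
            value : ⟪ coord tf , αF a c ⟫ ≡ signed (ascent? tf) (1ℚ - 0ℚ)
            value = trans (coord-αF tf a c) (cong (signed (ascent? tf)) (cong₂ _-_
                      (𝟙-yes (pa <? _) (ℕ.s≤s (subst (pa ℕ.≤_) (sym (Fin.toℕ-fromℕ< t<n)) pa≤t)))
                      (𝟙-no (pc <? _) (λ pc<1+t → ℕ.<⇒≱ t<pc (ℕ.s≤s⁻¹ (subst (pc ℕ.<_) (cong suc (Fin.toℕ-fromℕ< t<n)) pc<1+t))))))
            forced : ∀ β → ascent? tf ≡ β → ascent? tf ≡ true
            forced true  asc = asc
            forced false asc = ⊥-elim (-1≱0 (subst (0ℚ ≤_) (trans value (cong (λ β → signed β (1ℚ - 0ℚ)) asc)) (wSimple-cone⁻ αF∈ tf)))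
        falling : pc ℕ.≤ t → t ℕ.< pa → ¬ Ascent w t
        falling pc≤t t<pa asc-t = -1≱0 (subst (0ℚ ≤_) value (wSimple-cone⁻ αF∈ tf))
          where
            t<n = ℕ.<-≤-trans t<pa (ℕ.s≤s⁻¹ (⟦⟧⁻¹<N w (Fin.toℕ<n a)))
            tf = fromℕ< t<n
            ascent : ascent? tf ≡ true
            ascent = Equivalence.from (ascent?≡true⇔ tf) (subst (Ascent w) (sym (Fin.toℕ-fromℕ< t<n)) asc-t)
            value : ⟪ coord tf , αF a c ⟫ ≡ - 1ℚ
            value = trans (coord-αF tf a c) (cong₂ signed ascent (cong₂ _-_
                      (𝟙-no (pa <? _) (λ pa<1+t → ℕ.<⇒≱ t<pa (ℕ.s≤s⁻¹ (subst (pa ℕ.<_) (cong suc (Fin.toℕ-fromℕ< t<n)) pa<1+t))))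
                      (𝟙-yes (pc <? _) (ℕ.s≤s (subst (pc ℕ.≤_) (sym (Fin.toℕ-fromℕ< t<n)) pc≤t)))))

    Ascends⇒cone : Ascends w (toℕ a) (toℕ c) → InCone (wSimple w) (αF a c)
    Ascends⇒cone ascends = wSimple-cone⁺ (sumV-αF a c) (λ t → subst (0ℚ ≤_) (sym (coord-αF t a c))
                             (by-position t (pa <? suc (toℕ t)) (pc <? suc (toℕ t))))
      where
        by-position : ∀ t (a? : Dec (pa ℕ.< suc (toℕ t))) (c? : Dec (pc ℕ.< suc (toℕ t))) → 0ℚ ≤ signed (ascent? t) (𝟙 a? - 𝟙 c?)
        by-position t (yes _) (yes _) = ℚ.≤-reflexive (sym (signed-zero (ascent? t)))
        by-position t (no _)  (no _)  = ℚ.≤-reflexive (sym (signed-zero (ascent? t)))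
        by-position t (yes pa≤t) (no pc≰t) =
          subst (λ β → 0ℚ ≤ signed β (1ℚ - 0ℚ)) (sym (Equivalence.from (ascent?≡true⇔ t) (proj₁ (ascends (toℕ t)) (ℕ.s≤s⁻¹ pa≤t) (ℕ.≰⇒> (pc≰t ∘ ℕ.s≤s)))))
                0≤1
        by-position t (no pa≰t) (yes pc≤t) =
          subst (λ β → 0ℚ ≤ signed β (0ℚ - 1ℚ)) (sym (not-ascent (proj₂ (ascends (toℕ t)) (ℕ.s≤s⁻¹ pc≤t) (ℕ.≰⇒> (pa≰t ∘ ℕ.s≤s)))))
                0≤1
          where
            not-ascent : ¬ Ascent w (toℕ t) → ascent? t ≡ false
            not-ascent ¬asc with ascent? t in asc
            ... | false = refl
            ... | true  = ⊥-elim (¬asc (Equivalence.to (ascent?≡true⇔ t) asc))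

    αF∈cone⇔Ascends : InCone (wSimple w) (αF a c) ⇔ Ascends w (toℕ a) (toℕ c)
    αF∈cone⇔Ascends = mk⇔ cone⇒Ascends Ascends⇒cone


module Chambers where
  open Sums
  open Cone
  open Positions
  open import Data.Nat as ℕ using (zero; suc; _≤_; _<_; _+_; _∸_)
  import Data.Nat.Properties as ℕ
  open import Data.Fin using (toℕ; zero; fromℕ; fromℕ<)
  import Data.Fin.Properties as Fin
  open import Data.List using (List; map)
  open import Data.List.Membership.Propositional using (_∈_)
  open import Data.List.Membership.Propositional.Properties using (∈-map⁺; ∈-map⁻; ∈-upTo⁺; ∈-upTo⁻; ∈-++⁺ˡ; ∈-++⁺ʳ; ∈-++⁻)
  open import Data.List.Relation.Unary.Any using (here)
  open import Data.Product using (_×_; _,_; proj₁; proj₂)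
  open import Data.Sum using (inj₁; inj₂)
  open import Data.Empty using (⊥-elim)
  open import Function using (_∘_; mk⇔; Equivalence)
  open import Function.Properties.Equivalence using () renaming (trans to ⇔-trans)
  open import Function.Bundles using (_⇔_)
  open import Relation.Binary.PropositionalEquality

  ∈-range⁺ : ∀ {a b j} → a ≤ j → j ≤ b → j ∈ range a b
  ∈-range⁺ {a} {b} {j} a≤j j≤b = subst (_∈ range a b) (ℕ.m+[n∸m]≡n a≤j) (∈-map⁺ (a +_) (∈-upTo⁺ (ℕ.∸-monoˡ-< (ℕ.s≤s j≤b) a≤j)))

  ∈-range⁻ : ∀ a b {j} → j ∈ range a b → a ≤ j × j ≤ b
  ∈-range⁻ a b j∈ with ∈-map⁻ (a +_) j∈
  ... | k , k∈ , refl = ℕ.m≤m+n a k , ℕ.s≤s⁻¹ (subst (_≤ suc b) (cong suc (ℕ.+-comm k a)) (ℕ.m≤o∸n⇒m+n≤o (suc k) a≤1+b (∈-upTo⁻ k∈)))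
    where
      a≤1+b : a ≤ suc b
      a≤1+b with ℕ.≤-total a (suc b)
      ... | inj₁ a≤1+b = a≤1+b
      ... | inj₂ 1+b≤a = ⊥-elim (ℕ.n≮0 (subst (k <_) (ℕ.m≤n⇒m∸n≡0 1+b≤a) (∈-upTo⁻ k∈)))

  module _ {n f : ℕ} (1≤f : 1 ≤ f) (f≤n : f ≤ n) where
    open DoubleStar f 1≤f f≤n

    W⇔DoubleStarCond : ∀ {gens} {w : Permutation′ (suc n)} → (∀ {g} → Edge g → g ∈ gens) → (∀ {g} → g ∈ gens → Edge g) →
                       W (suc n) gens w ⇔ DoubleStarCond w f n
    W⇔DoubleStarCond {gens} {w} Edge⊆gens gens⊆Edge = mk⇔
      (edges⇒cond ∘ Equivalence.to (W⇔Edges⊆cone {gens} {w} Edge⊆gens gens⊆Edge))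
      (Equivalence.from (W⇔Edges⊆cone {gens} {w} Edge⊆gens gens⊆Edge) ∘ cond⇒edges)
      where
        open RootInCone w
        toℕ-last = Fin.toℕ-fromℕ n
        edges⇒cond : (∀ {g} → Edge g → InCone (wSimple w) g) → DoubleStarCond w f n
        edges⇒cond edges⊆ = inner-ascends , outer-ascends , bridge-ascends
          where
            inner-ascends : ∀ a → 1 ≤ a → a < f → Ascends w 0 a
            inner-ascends a 1≤a a<f = subst (Ascends w 0) (Fin.toℕ-fromℕ< a<1+n)
              (Equivalence.to (αF∈cone⇔Ascends zero (fromℕ< a<1+n))
                (edges⊆ (inner (subst (1 ≤_) (sym (Fin.toℕ-fromℕ< a<1+n)) 1≤a) (subst (_< f) (sym (Fin.toℕ-fromℕ< a<1+n)) a<f))))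
              where a<1+n = ℕ.<-≤-trans a<f (ℕ.m≤n⇒m≤1+n f≤n)
            outer-ascends : ∀ a → f ≤ a → a < n → Ascends w a n
            outer-ascends a f≤a a<n = subst₂ (Ascends w) (Fin.toℕ-fromℕ< a<1+n) toℕ-last
              (Equivalence.to (αF∈cone⇔Ascends (fromℕ< a<1+n) last)
                (edges⊆ (outer (subst (f ≤_) (sym (Fin.toℕ-fromℕ< a<1+n)) f≤a) (subst (_< n) (sym (Fin.toℕ-fromℕ< a<1+n)) a<n))))
              where a<1+n = ℕ.m<n⇒m<1+n a<n
            bridge-ascends : Ascends w 0 n
            bridge-ascends = subst (Ascends w 0) toℕ-last (Equivalence.to (αF∈cone⇔Ascends zero last) (edges⊆ bridge))
        cond⇒edges : DoubleStarCond w f n → ∀ {g} → Edge g → InCone (wSimple w) g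
        cond⇒edges (inner-ascends , _ , _) (inner {a} 1≤a a<f) =
          Equivalence.from (αF∈cone⇔Ascends zero a) (inner-ascends (toℕ a) 1≤a a<f)
        cond⇒edges (_ , outer-ascends , _) (outer {a} f≤a a<n) =
          Equivalence.from (αF∈cone⇔Ascends a last) (subst (Ascends w (toℕ a)) (sym toℕ-last) (outer-ascends (toℕ a) f≤a a<n))
        cond⇒edges (_ , _ , bridge-ascends) bridge =
          Equivalence.from (αF∈cone⇔Ascends zero last) (subst (Ascends w 0) (sym toℕ-last) bridge-ascends)

  αF-last : ∀ {n} (a : Fin (suc n)) → αF a (fromℕ n) ≡ α (suc (toℕ a)) (suc n)
  αF-last {n} a = cong (λ k → α (suc (toℕ a)) (suc k)) (Fin.toℕ-fromℕ n)

  label-fromℕ< : ∀ {N i} (i<N : i < N) → suc (toℕ (fromℕ< i<N)) ≡ suc i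
  label-fromℕ< i<N = cong suc (Fin.toℕ-fromℕ< i<N)

  module _ {n : ℕ} (1≤n : 1 ≤ n) where
    open DoubleStar n 1≤n ℕ.≤-refl

    W-star : ∀ {w : Permutation′ (suc n)} → W (suc n) (gens1 (suc n)) w ⇔ DoubleStarCond w n n
    W-star = W⇔DoubleStarCond 1≤n ℕ.≤-refl Edge⇒∈ ∈⇒Edge
      where
        Edge⇒∈ : ∀ {g} → Edge g → g ∈ gens1 (suc n)
        Edge⇒∈ (inner 1≤a a<n) = ∈-map⁺ (α 1) (∈-range⁺ (ℕ.s≤s 1≤a) (ℕ.<⇒≤ (ℕ.s≤s a<n)))
        Edge⇒∈ (outer n≤a a<n) = ⊥-elim (ℕ.<⇒≱ a<n n≤a)
        Edge⇒∈ bridge          = subst (_∈ gens1 (suc n)) (sym (αF-last zero)) (∈-map⁺ (α 1) (∈-range⁺ (ℕ.s≤s 1≤n) ℕ.≤-refl))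
        ∈⇒Edge : ∀ {g} → g ∈ gens1 (suc n) → Edge g
        ∈⇒Edge g∈ with ∈-map⁻ (α 1) g∈
        ... | j , j∈ , refl with ∈-range⁻ 2 (suc n) j∈
        ...   | 2≤j , j≤1+n with ℕ.m≤n⇒m<n∨m≡n j≤1+n
        ...     | inj₂ refl = subst Edge (αF-last zero) bridge
        ...     | inj₁ j<1+n with j
        ...       | suc k = subst Edge (cong (α 1) (label-fromℕ< k<1+n)) (inner (subst (1 ≤_) (sym (Fin.toℕ-fromℕ< k<1+n)) (ℕ.s≤s⁻¹ 2≤j))
                                                             (subst (_< n) (sym (Fin.toℕ-fromℕ< k<1+n)) (ℕ.s≤s⁻¹ j<1+n)))
          where k<1+n = ℕ.m<n⇒m<1+n (ℕ.s≤s⁻¹ j<1+n)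

  module _ {n : ℕ} (1≤n : 1 ≤ n) where
    open DoubleStar 1 ℕ.≤-refl 1≤n

    W-top : ∀ {w : Permutation′ (suc n)} → W (suc n) (gensTop (suc n)) w ⇔ DoubleStarCond w 1 n
    W-top = W⇔DoubleStarCond ℕ.≤-refl 1≤n Edge⇒∈ ∈⇒Edge
      where
        Edge⇒∈ : ∀ {g} → Edge g → g ∈ gensTop (suc n)
        Edge⇒∈ (inner 1≤a a<1)   = ⊥-elim (ℕ.<⇒≱ a<1 1≤a)
        Edge⇒∈ (outer {a} _ a<n) = subst (_∈ gensTop (suc n)) (sym (αF-last a)) (∈-map⁺ (λ j → α j (suc n)) (∈-range⁺ (ℕ.s≤s ℕ.z≤n) a<n))
        Edge⇒∈ bridge            = subst (_∈ gensTop (suc n)) (sym (αF-last zero)) (∈-map⁺ (λ j → α j (suc n)) (∈-range⁺ ℕ.≤-refl 1≤n))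
        ∈⇒Edge : ∀ {g} → g ∈ gensTop (suc n) → Edge g
        ∈⇒Edge g∈ with ∈-map⁻ (λ j → α j (suc n)) g∈
        ... | j , j∈ , refl with ∈-range⁻ 1 n j∈
        ...   | 1≤j , j≤n with j
        ...     | suc zero    = subst Edge (αF-last zero) bridge
        ...     | suc (suc k) = subst Edge (trans (αF-last (fromℕ< 1+k<1+n)) (cong (λ i → α i (suc n)) (label-fromℕ< 1+k<1+n)))
                                  (outer (subst (1 ≤_) (sym (Fin.toℕ-fromℕ< 1+k<1+n)) (ℕ.s≤s ℕ.z≤n))
                                         (subst (_< n) (sym (Fin.toℕ-fromℕ< 1+k<1+n)) j≤n))
          where 1+k<1+n = ℕ.m<n⇒m<1+n j≤n

  module _ {n m : ℕ} (1≤f : 1 ≤ suc n ∸ m) (f≤n : suc n ∸ m ≤ n) where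
    private f = suc n ∸ m
    open DoubleStar f 1≤f f≤n

    W-mid : ∀ {w : Permutation′ (suc n)} → W (suc n) (gensMid (suc n) m) w ⇔ DoubleStarCond w f n
    W-mid = W⇔DoubleStarCond 1≤f f≤n Edge⇒∈ ∈⇒Edge
      where
        inners = map (α 1) (range 2 f)
        outers = map (λ j → α j (suc n)) (range (suc f) n)
        Edge⇒∈ : ∀ {g} → Edge g → g ∈ gensMid (suc n) m
        Edge⇒∈ (inner 1≤a a<f)   = ∈-++⁺ˡ (∈-map⁺ (α 1) (∈-range⁺ (ℕ.s≤s 1≤a) a<f))
        Edge⇒∈ (outer {a} f≤a a<n) = subst (_∈ gensMid (suc n) m) (sym (αF-last a))
                                      (∈-++⁺ʳ inners (∈-++⁺ˡ (∈-map⁺ (λ j → α j (suc n)) (∈-range⁺ (ℕ.s≤s f≤a) a<n))))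
        Edge⇒∈ bridge            = subst (_∈ gensMid (suc n) m) (sym (αF-last zero)) (∈-++⁺ʳ inners (∈-++⁺ʳ outers (here refl)))
        ∈⇒Edge : ∀ {g} → g ∈ gensMid (suc n) m → Edge g
        ∈⇒Edge g∈ with ∈-++⁻ inners g∈
        ... | inj₁ g∈inners with ∈-map⁻ (α 1) g∈inners
        ...   | zero  , j∈ , refl = ⊥-elim (ℕ.n≮0 (proj₁ (∈-range⁻ 2 f j∈)))
        ...   | suc k , j∈ , refl = subst Edge (cong (α 1) (label-fromℕ< k<1+n))
                                      (inner (subst (1 ≤_) (sym (Fin.toℕ-fromℕ< k<1+n)) (ℕ.s≤s⁻¹ 2≤j))
                                             (subst (_< f) (sym (Fin.toℕ-fromℕ< k<1+n)) j≤f))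
          where
            2≤j = proj₁ (∈-range⁻ 2 f j∈)
            j≤f = proj₂ (∈-range⁻ 2 f j∈)
            k<1+n = ℕ.<-≤-trans j≤f (ℕ.m≤n⇒m≤1+n f≤n)
        ∈⇒Edge g∈ | inj₂ g∈rest with ∈-++⁻ outers g∈rest
        ... | inj₂ (here refl) = subst Edge (αF-last zero) bridge
        ... | inj₁ g∈outers with ∈-map⁻ (λ j → α j (suc n)) g∈outers
        ...   | zero  , j∈ , refl = ⊥-elim (ℕ.n≮0 (proj₁ (∈-range⁻ (suc f) n j∈)))
        ...   | suc k , j∈ , refl = subst Edge (trans (αF-last (fromℕ< k<1+n)) (cong (λ i → α i (suc n)) (label-fromℕ< k<1+n)))
                                      (outer (subst (f ≤_) (sym (Fin.toℕ-fromℕ< k<1+n)) (ℕ.s≤s⁻¹ 1+f≤j))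
                                             (subst (_< n) (sym (Fin.toℕ-fromℕ< k<1+n)) j≤n))
          where
            1+f≤j = proj₁ (∈-range⁻ (suc f) n j∈)
            j≤n = proj₂ (∈-range⁻ (suc f) n j∈)
            k<1+n = ℕ.m<n⇒m<1+n j≤n

  W-gens1⇔StarCond : ∀ {N} (u : Permutation′ N) → 2 ≤ N → W N (gens1 N) u ⇔ StarCond u
  W-gens1⇔StarCond {1} u (ℕ.s≤s ())
  W-gens1⇔StarCond {suc (suc n)} u _ = ⇔-trans (W-star (ℕ.s≤s ℕ.z≤n)) (mk⇔ to from)
    where
      to : DoubleStarCond u (suc n) (suc n) → StarCond u
      to (inner , _ , bridge) a 0<a a<N with ℕ.m≤n⇒m<n∨m≡n (ℕ.s≤s⁻¹ a<N)
      ... | inj₁ a<top = inner a 0<a a<top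
      ... | inj₂ refl  = bridge
      from : StarCond u → DoubleStarCond u (suc n) (suc n)
      from star = (λ a 0<a a<top → star a 0<a (ℕ.m<n⇒m<1+n a<top))
                , (λ a top≤a a<top → ⊥-elim (ℕ.<⇒≱ a<top top≤a))
                , star (suc n) (ℕ.s≤s ℕ.z≤n) ℕ.≤-refl

  W-gensTop⇔TopCond : ∀ {N} (v : Permutation′ N) → 2 ≤ N → W N (gensTop N) v ⇔ TopCond v (N ∸ 1)
  W-gensTop⇔TopCond {1} v (ℕ.s≤s ())
  W-gensTop⇔TopCond {suc (suc n)} v _ = ⇔-trans (W-top (ℕ.s≤s ℕ.z≤n)) (mk⇔ to from)
    where
      to : DoubleStarCond v 1 (suc n) → TopCond v (suc n)
      to (_ , outer , bridge) zero    _     = bridge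
      to (_ , outer , bridge) (suc a) a<top = outer (suc a) (ℕ.s≤s ℕ.z≤n) a<top
      from : TopCond v (suc n) → DoubleStarCond v 1 (suc n)
      from top = (λ a 1≤a a<1 → ⊥-elim (ℕ.<⇒≱ a<1 1≤a))
               , (λ a _ a<top → top a a<top)
               , top 0 (ℕ.s≤s ℕ.z≤n)

module Blocks where
  open Positions
  open import Data.Nat as ℕ using (suc; _≤_; _<_; _+_; _∸_)
  import Data.Nat.Properties as ℕ
  open import Data.Fin using (toℕ; fromℕ<)
  import Data.Fin.Properties as Fin
  open import Data.Fin.Permutation using (permutation; flip)
  open import Data.Product using (Σ; _×_; _,_; proj₁; proj₂)
  open import Data.Sum using (_⊎_; inj₁; inj₂)
  open import Data.Empty using (⊥-elim)
  open import Function using (_∘_; mk⇔; Equivalence)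
  open import Function.Bundles using (_⇔_)
  open import Relation.Binary.PropositionalEquality
  open import Relation.Binary.Definitions using (tri<; tri≈; tri>)
  open import Relation.Nullary using (¬_; yes; no)

  private variable
    M N : ℕ
    a b c s t : ℕ

  ascent-after-bottom : ∀ (w : Permutation′ N) → (∀ a → a < N → a ≢ b → Ascends w b a) →
                        w ⟦ b ⟧⁻¹ ≤ t → suc t < N → Ascent w t
  ascent-after-bottom {b = b} {t} w rises pb≤t 1+t<N =
    proj₁ (rises (w ⟦ suc t ⟧) (⟦⟧<N w 1+t<N) next≢b t) pb≤t (subst (t <_) (sym (⟦⟦⟧⟧⁻¹ w 1+t<N)) ℕ.≤-refl)
    where
      next≢b : w ⟦ suc t ⟧ ≢ b
      next≢b next≡b = ℕ.<-irrefl refl (ℕ.<-≤-trans (subst (t <_) (trans (sym (⟦⟦⟧⟧⁻¹ w 1+t<N)) (cong (w ⟦_⟧⁻¹) next≡b)) ℕ.≤-refl) pb≤t)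

  ascent-before-top : ∀ (w : Permutation′ N) → (∀ a → a < N → a ≢ c → Ascends w a c) →
                      t < w ⟦ c ⟧⁻¹ → c < N → Ascent w t
  ascent-before-top {c = c} {t} w falls t<pc c<N =
    proj₁ (falls (w ⟦ t ⟧) (⟦⟧<N w t<N) current≢c t) (ℕ.≤-reflexive (⟦⟦⟧⟧⁻¹ w t<N)) t<pc
    where
      t<N = ℕ.<-trans t<pc (⟦⟧⁻¹<N w c<N)
      current≢c : w ⟦ t ⟧ ≢ c
      current≢c current≡c = ℕ.<-irrefl (trans (sym (⟦⟦⟧⟧⁻¹ w t<N)) (cong (w ⟦_⟧⁻¹) current≡c)) t<pc

  record Embeds (u : Permutation′ M) (w : Permutation′ N) (s : ℕ) : Set where
    field
      fits   : s + M ≤ N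
      agrees : ∀ t → t < M → w ⟦ s + t ⟧ ≡ s + u ⟦ t ⟧

  module _ {u : Permutation′ M} {w : Permutation′ N} {s : ℕ} (u⊆w : Embeds u w s) where
    open Embeds u⊆w

    inside : t < M → s + t < N
    inside t<M = ℕ.<-≤-trans (ℕ.+-monoʳ-< s t<M) fits

    embeds-position : a < M → w ⟦ s + a ⟧⁻¹ ≡ s + u ⟦ a ⟧⁻¹
    embeds-position {a} a<M = begin
      w ⟦ s + a ⟧⁻¹                        ≡⟨ cong (λ v → w ⟦ s + v ⟧⁻¹) (sym (⟦⟦⟧⁻¹⟧ u a<M)) ⟩
      w ⟦ s + u ⟦ p ⟧ ⟧⁻¹                  ≡⟨ cong (w ⟦_⟧⁻¹) (sym (agrees p p<M)) ⟩
      w ⟦ w ⟦ s + p ⟧ ⟧⁻¹                  ≡⟨ ⟦⟦⟧⟧⁻¹ w (inside p<M) ⟩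
      s + p                                ∎
      where
        open ≡-Reasoning
        p = u ⟦ a ⟧⁻¹
        p<M = ⟦⟧⁻¹<N u a<M

    embeds-ascent : suc t < M → Ascent w (s + t) ⇔ Ascent u t
    embeds-ascent {t} 1+t<M = mk⇔ (ℕ.+-cancelˡ-< s _ _ ∘ subst₂ _<_ low high) (subst₂ _<_ (sym low) (sym high) ∘ ℕ.+-monoʳ-< s)
      where
        low  = agrees t (ℕ.<-trans (ℕ.n<1+n t) 1+t<M)
        high = trans (cong (w ⟦_⟧) (sym (ℕ.+-suc s t))) (agrees (suc t) 1+t<M)

    ascends-restrict : a < M → c < M → Ascends w (s + a) (s + c) → Ascends u a c
    ascends-restrict {a} {c} a<M c<M rises t = rising , falling
      where
        pa = embeds-position a<M
        pc = embeds-position c<M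
        rising : u ⟦ a ⟧⁻¹ ≤ t → t < u ⟦ c ⟧⁻¹ → Ascent u t
        rising pa≤t t<pc = Equivalence.to (embeds-ascent (ℕ.<-≤-trans (ℕ.s≤s t<pc) (⟦⟧⁻¹<N u c<M)))
          (proj₁ (rises (s + t)) (subst (_≤ s + t) (sym pa) (ℕ.+-monoʳ-≤ s pa≤t)) (subst (s + t <_) (sym pc) (ℕ.+-monoʳ-< s t<pc)))
        falling : u ⟦ c ⟧⁻¹ ≤ t → t < u ⟦ a ⟧⁻¹ → ¬ Ascent u t
        falling pc≤t t<pa = proj₂ (rises (s + t)) (subst (_≤ s + t) (sym pc) (ℕ.+-monoʳ-≤ s pc≤t)) (subst (s + t <_) (sym pa) (ℕ.+-monoʳ-< s t<pa))
                          ∘ Equivalence.from (embeds-ascent (ℕ.<-≤-trans (ℕ.s≤s t<pa) (⟦⟧⁻¹<N u a<M)))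

    ascends-extend : a < M → c < M → Ascends u a c → Ascends w (s + a) (s + c)
    ascends-extend {a} {c} a<M c<M rises t = rising , falling
      where
        pa = embeds-position a<M
        pc = embeds-position c<M
        shifted : ∀ {p q} → s + p ≤ t → t < s + q → Σ ℕ λ t′ → t ≡ s + t′ × p ≤ t′ × t′ < q
        shifted {p} s+p≤t t<s+q = t ∸ s , sym s+t′≡t , ℕ.+-cancelˡ-≤ s _ _ (subst (s + p ≤_) (sym s+t′≡t) s+p≤t)
                                                     , ℕ.+-cancelˡ-< s _ _ (subst (_< s + _) (sym s+t′≡t) t<s+q)
          where s+t′≡t = ℕ.m+[n∸m]≡n (ℕ.≤-trans (ℕ.m≤m+n s p) s+p≤t)
        rising : w ⟦ s + a ⟧⁻¹ ≤ t → t < w ⟦ s + c ⟧⁻¹ → Ascent w t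
        rising pa≤t t<pc with shifted (subst (_≤ t) pa pa≤t) (subst (t <_) pc t<pc)
        ... | t′ , refl , pa≤t′ , t′<pc = Equivalence.from (embeds-ascent (ℕ.<-≤-trans (ℕ.s≤s t′<pc) (⟦⟧⁻¹<N u c<M)))
                                            (proj₁ (rises t′) pa≤t′ t′<pc)
        falling : w ⟦ s + c ⟧⁻¹ ≤ t → t < w ⟦ s + a ⟧⁻¹ → ¬ Ascent w t
        falling pc≤t t<pa with shifted (subst (_≤ t) pc pc≤t) (subst (t <_) pa t<pa)
        ... | t′ , refl , pc≤t′ , t′<pa = proj₂ (rises t′) pc≤t′ t′<pa
                                          ∘ Equivalence.to (embeds-ascent (ℕ.<-≤-trans (ℕ.s≤s t′<pa) (⟦⟧⁻¹<N u a<M)))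

  restriction : ∀ (w : Permutation′ N) s M → s + M ≤ N →
                (∀ t → t < M → s ≤ w ⟦ s + t ⟧ × w ⟦ s + t ⟧ < s + M) →
                (∀ v → v < M → s ≤ w ⟦ s + v ⟧⁻¹ × w ⟦ s + v ⟧⁻¹ < s + M) →
                Σ (Permutation′ M) λ u → Embeds u w s
  restriction {N} w s M fits stays stays⁻¹ = u , record { fits = fits ; agrees = agrees }
    where
      Stays : Permutation′ N → Set
      Stays π = ∀ t → t < M → s ≤ π ⟦ s + t ⟧ × π ⟦ s + t ⟧ < s + M
      drop : ∀ {x} → s ≤ x × x < s + M → x ∸ s < M
      drop (s≤x , x<s+M) = ℕ.+-cancelˡ-< s _ _ (subst (_< s + M) (sym (ℕ.m+[n∸m]≡n s≤x)) x<s+M)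
      restrict : (π : Permutation′ N) → Stays π → Fin M → Fin M
      restrict π π-stays j = fromℕ< (drop (π-stays (toℕ j) (Fin.toℕ<n j)))
      round-trip : (π : Permutation′ N) (π-stays : Stays π) (π⁻¹-stays : Stays (flip π)) →
                   ∀ j → restrict (flip π) π⁻¹-stays (restrict π π-stays j) ≡ j
      round-trip π π-stays π⁻¹-stays j = Fin.toℕ-injective (begin
        toℕ (restrict (flip π) π⁻¹-stays (restrict π π-stays j))   ≡⟨ Fin.toℕ-fromℕ< _ ⟩
        π ⟦ s + toℕ (restrict π π-stays j) ⟧⁻¹ ∸ s                  ≡⟨ cong (λ x → π ⟦ s + x ⟧⁻¹ ∸ s) (Fin.toℕ-fromℕ< _) ⟩
        π ⟦ s + (π ⟦ s + toℕ j ⟧ ∸ s) ⟧⁻¹ ∸ s                      ≡⟨ cong (λ x → π ⟦ x ⟧⁻¹ ∸ s) (ℕ.m+[n∸m]≡n (proj₁ (π-stays (toℕ j) (Fin.toℕ<n j)))) ⟩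
        π ⟦ π ⟦ s + toℕ j ⟧ ⟧⁻¹ ∸ s                               ≡⟨ cong (_∸ s) (⟦⟦⟧⟧⁻¹ π (ℕ.<-≤-trans (ℕ.+-monoʳ-< s (Fin.toℕ<n j)) fits)) ⟩
        s + toℕ j ∸ s                                            ≡⟨ ℕ.m+n∸m≡n s (toℕ j) ⟩
        toℕ j                                                    ∎)
        where open ≡-Reasoning
      u : Permutation′ M
      u = permutation (restrict w stays) (restrict (flip w) stays⁻¹) (round-trip (flip w) stays⁻¹ stays) (round-trip w stays stays⁻¹)
      agrees : ∀ t → t < M → w ⟦ s + t ⟧ ≡ s + u ⟦ t ⟧
      agrees t t<M = sym (begin
        s + u ⟦ t ⟧                                   ≡⟨ cong (s +_) (⟦⟧-fromℕ< u t<M) ⟩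
        s + toℕ (restrict w stays (fromℕ< t<M))       ≡⟨ cong (s +_) (Fin.toℕ-fromℕ< _) ⟩
        s + (w ⟦ s + toℕ (fromℕ< t<M) ⟧ ∸ s)          ≡⟨ cong (λ t′ → s + (w ⟦ s + t′ ⟧ ∸ s)) (Fin.toℕ-fromℕ< t<M) ⟩
        s + (w ⟦ s + t ⟧ ∸ s)                         ≡⟨ ℕ.m+[n∸m]≡n (proj₁ (stays t t<M)) ⟩
        w ⟦ s + t ⟧                                   ∎)
        where open ≡-Reasoning

  initial-segment : ∀ (w : Permutation′ N) {f} →
                    (∀ s t → s < t → t < N → w ⟦ t ⟧ < f → w ⟦ s ⟧ < f) →
                    ∀ t → t < N → t < f ⇔ w ⟦ t ⟧ < f
  initial-segment {N} w {f} downward t t<N = mk⇔ stays-low comes-from-low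
    where
      stays-low : t < f → w ⟦ t ⟧ < f
      stays-low t<f with w ⟦ t ⟧ ℕ.<? f
      ... | yes wt<f = wt<f
      ... | no  wt≮f = ⊥-elim (ℕ.<⇒≱ t<f (Fin.injective⇒≤ {f = position} position-injective))
        where
          f≤N : f ≤ N
          f≤N = ℕ.≤-trans (ℕ.≮⇒≥ wt≮f) (ℕ.<⇒≤ (⟦⟧<N w t<N))
          before-t : ∀ v → v < f → w ⟦ v ⟧⁻¹ < t
          before-t v v<f = ℕ.≰⇒> λ t≤p → wt≮f (at-or-after (ℕ.m≤n⇒m<n∨m≡n t≤p))
            where
              v<N = ℕ.<-≤-trans v<f f≤N
              wp<f : w ⟦ w ⟦ v ⟧⁻¹ ⟧ < f
              wp<f = subst (_< f) (sym (⟦⟦⟧⁻¹⟧ w v<N)) v<f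
              at-or-after : t < w ⟦ v ⟧⁻¹ ⊎ t ≡ w ⟦ v ⟧⁻¹ → w ⟦ t ⟧ < f
              at-or-after (inj₁ t<p)  = downward t _ t<p (⟦⟧⁻¹<N w v<N) wp<f
              at-or-after (inj₂ refl) = wp<f
          position : Fin f → Fin t
          position v = fromℕ< (before-t (toℕ v) (Fin.toℕ<n v))
          position-injective : ∀ {v v′} → position v ≡ position v′ → v ≡ v′
          position-injective eq = Fin.toℕ-injective (⟦⟧⁻¹-injective w (ℕ.<-≤-trans (Fin.toℕ<n _) f≤N) (ℕ.<-≤-trans (Fin.toℕ<n _) f≤N)
                                    (Fin.fromℕ<-injective _ _ _ _ eq))
      comes-from-low : w ⟦ t ⟧ < f → t < f
      comes-from-low wt<f = ℕ.≰⇒> λ f≤t → ℕ.<⇒≱ (ℕ.s≤s f≤t) (Fin.injective⇒≤ {f = value} value-injective)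
        where
          low-before : ∀ s → s ≤ t → w ⟦ s ⟧ < f
          low-before s s≤t with ℕ.m≤n⇒m<n∨m≡n s≤t
          ... | inj₁ s<t  = downward s t s<t t<N wt<f
          ... | inj₂ refl = wt<f
          value : Fin (suc t) → Fin f
          value s = fromℕ< (low-before (toℕ s) (ℕ.s≤s⁻¹ (Fin.toℕ<n s)))
          value-injective : ∀ {s s′} → value s ≡ value s′ → s ≡ s′
          value-injective eq = Fin.toℕ-injective (⟦⟧-injective w (ℕ.<-≤-trans (Fin.toℕ<n _) t<N) (ℕ.<-≤-trans (Fin.toℕ<n _) t<N)
                                 (Fin.fromℕ<-injective _ _ _ _ eq))


  module _ {N f : ℕ} {w : Permutation′ N} where

    StarCond-restrict : ∀ {u : Permutation′ f} → Embeds u w 0 → ∀ {top} → DoubleStarCond w f top → StarCond u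
    StarCond-restrict u⊆w (inner , _ , _) a 0<a a<f = ascends-restrict u⊆w (ℕ.<-trans 0<a a<f) a<f (inner a 0<a a<f)

    TopCond-restrict : ∀ {c M} {v : Permutation′ M} → suc c ≡ M → Embeds v w f → DoubleStarCond w f (f + c) → TopCond v c
    TopCond-restrict {c} refl v⊆w (_ , outer , _) a a<c =
      ascends-restrict v⊆w (ℕ.m<n⇒m<1+n a<c) ℕ.≤-refl (outer (f + a) (ℕ.m≤m+n f a) (ℕ.+-monoʳ-< f a<c))

    split-blocks : ∀ {M} → f + M ≡ N → (∀ t → t < N → t < f ⇔ w ⟦ t ⟧ < f) →
                   Σ (Permutation′ f) (λ u → Embeds u w 0) × Σ (Permutation′ M) (λ v → Embeds v w f)
    split-blocks {M} refl low⇔low = restriction w 0 f (ℕ.m≤m+n f M) low-stays low-stays⁻¹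
                                   , restriction w f M ℕ.≤-refl high-stays high-stays⁻¹
      where
        low-stays : ∀ t → t < f → 0 ≤ w ⟦ t ⟧ × w ⟦ t ⟧ < f
        low-stays t t<f = ℕ.z≤n , Equivalence.to (low⇔low t (ℕ.<-≤-trans t<f (ℕ.m≤m+n f M))) t<f
        low-stays⁻¹ : ∀ v → v < f → 0 ≤ w ⟦ v ⟧⁻¹ × w ⟦ v ⟧⁻¹ < f
        low-stays⁻¹ v v<f = ℕ.z≤n , Equivalence.from (low⇔low _ (⟦⟧⁻¹<N w v<N)) (subst (_< f) (sym (⟦⟦⟧⁻¹⟧ w v<N)) v<f)
          where v<N = ℕ.<-≤-trans v<f (ℕ.m≤m+n f M)
        high-stays : ∀ t → t < M → f ≤ w ⟦ f + t ⟧ × w ⟦ f + t ⟧ < f + M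
        high-stays t t<M = ℕ.≮⇒≥ (λ wt<f → ℕ.m+n≮m f t (Equivalence.from (low⇔low (f + t) f+t<N) wt<f)) , ⟦⟧<N w f+t<N
          where f+t<N = ℕ.+-monoʳ-< f t<M
        high-stays⁻¹ : ∀ v → v < M → f ≤ w ⟦ f + v ⟧⁻¹ × w ⟦ f + v ⟧⁻¹ < f + M
        high-stays⁻¹ v v<M = ℕ.≮⇒≥ (λ p<f → ℕ.m+n≮m f v (subst (_< f) (⟦⟦⟧⁻¹⟧ w f+v<N) (Equivalence.to (low⇔low _ (⟦⟧⁻¹<N w f+v<N)) p<f)))
                           , ⟦⟧⁻¹<N w f+v<N
          where f+v<N = ℕ.+-monoʳ-< f v<M

    DoubleStarCond-extend : ∀ {c M} {u : Permutation′ f} {v : Permutation′ M} → suc c ≡ M → Embeds u w 0 → Embeds v w f →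
                            StarCond u → TopCond v c → 0 < f → DoubleStarCond w f (f + c)
    DoubleStarCond-extend {c} {u = u} {v} refl u⊆w v⊆w star top 0<f = inner , outer , bridge
      where
        inner : ∀ a → 1 ≤ a → a < f → Ascends w 0 a
        inner a 1≤a a<f = ascends-extend u⊆w 0<f a<f (star a 1≤a a<f)
        outer : ∀ a → f ≤ a → a < f + c → Ascends w a (f + c)
        outer a f≤a a<f+c = subst (λ b → Ascends w b (f + c)) (ℕ.m+[n∸m]≡n f≤a)
          (ascends-extend v⊆w (ℕ.m<n⇒m<1+n a′<c) ℕ.≤-refl (top (a ∸ f) a′<c))
          where a′<c = ℕ.+-cancelˡ-< f _ _ (subst (_< f + c) (sym (ℕ.m+[n∸m]≡n f≤a)) a<f+c)
        bottom-low : w ⟦ 0 ⟧⁻¹ ≡ u ⟦ 0 ⟧⁻¹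
        bottom-low = embeds-position u⊆w 0<f
        top-high : w ⟦ f + c ⟧⁻¹ ≡ f + v ⟦ c ⟧⁻¹
        top-high = embeds-position v⊆w ℕ.≤-refl
        rising : ∀ t → w ⟦ 0 ⟧⁻¹ ≤ t → t < w ⟦ f + c ⟧⁻¹ → Ascent w t
        rising t p₀≤t t<pₜ with ℕ.<-cmp (suc t) f
        ... | tri< 1+t<f _ _ = Equivalence.from (embeds-ascent u⊆w 1+t<f)
                                 (ascent-after-bottom u (λ a a<f a≢0 → star a (ℕ.n≢0⇒n>0 a≢0) a<f) (subst (_≤ t) bottom-low p₀≤t) 1+t<f)
        ... | tri≈ _ refl _  = ℕ.<-≤-trans (subst (_< suc t) (sym (Embeds.agrees u⊆w t ℕ.≤-refl)) (⟦⟧<N u ℕ.≤-refl))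
                                           (subst (suc t ≤_) (trans (sym (Embeds.agrees v⊆w 0 (ℕ.s≤s ℕ.z≤n))) (cong (w ⟦_⟧) (ℕ.+-identityʳ (suc t))))
                                                  (ℕ.m≤m+n (suc t) (v ⟦ 0 ⟧)))
        ... | tri> _ _ f<1+t = subst (Ascent w) (ℕ.m+[n∸m]≡n f≤t)
                                 (Equivalence.from (embeds-ascent v⊆w (ℕ.s≤s (ℕ.<-≤-trans t′<pc (ℕ.s≤s⁻¹ (⟦⟧⁻¹<N v ℕ.≤-refl)))))
                                   (ascent-before-top v (λ a a<1+c a≢c → top a (ℕ.≤∧≢⇒< (ℕ.s≤s⁻¹ a<1+c) a≢c)) t′<pc ℕ.≤-refl))
          where
            f≤t = ℕ.s≤s⁻¹ f<1+t
            t′<pc : t ∸ f < v ⟦ c ⟧⁻¹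
            t′<pc = ℕ.+-cancelˡ-< f _ _ (subst₂ _<_ (sym (ℕ.m+[n∸m]≡n f≤t)) top-high t<pₜ)
        bridge : Ascends w 0 (f + c)
        bridge t = rising t , λ pₜ≤t t<p₀ → ⊥-elim (ℕ.<-irrefl refl (ℕ.<-≤-trans t<p₀ (ℕ.≤-trans p₀≤f pₜ≤t)))
          where
            p₀≤f : w ⟦ 0 ⟧⁻¹ ≤ w ⟦ f + c ⟧⁻¹
            p₀≤f = ℕ.<⇒≤ (ℕ.<-≤-trans (subst (_< f) (sym bottom-low) (⟦⟧⁻¹<N u 0<f)) (subst (f ≤_) (sym top-high) (ℕ.m≤m+n f _)))

  -- Before w⁻¹(0) all values are < f, after w⁻¹(top) all are ≥ f, and in between w increases;
  -- so the positions of values < f form an initial segment.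
  preserves-initial : ∀ {top f} {w : Permutation′ (suc top)} → DoubleStarCond w f top → 0 < f → f ≤ top →
                      w ⟦ 0 ⟧⁻¹ < w ⟦ top ⟧⁻¹ → ∀ t → t < suc top → t < f ⇔ w ⟦ t ⟧ < f
  preserves-initial {top} {f} {w} (inner , outer , bridge) 0<f f≤top p₀<pₜ = initial-segment w downward
    where
      p₀ = w ⟦ 0 ⟧⁻¹
      pₜ = w ⟦ top ⟧⁻¹
      rising : ∀ t → p₀ ≤ t → t < pₜ → Ascent w t
      rising t = proj₁ (bridge t)
      value-p₀ : w ⟦ p₀ ⟧ ≡ 0
      value-p₀ = ⟦⟦⟧⁻¹⟧ w (ℕ.s≤s ℕ.z≤n)
      value-pₜ : w ⟦ pₜ ⟧ ≡ top
      value-pₜ = ⟦⟦⟧⁻¹⟧ w ℕ.≤-refl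
      early : ∀ t → t < p₀ → w ⟦ t ⟧ < f
      early t t<p₀ with w ⟦ t ⟧ ℕ.<? f
      ... | yes wt<f = wt<f
      ... | no  wt≮f = ⊥-elim (ℕ.n≮0 (subst (w ⟦ t ⟧ <_) value-p₀ (ascending-run w run t<p₀)))
        where
          t<N = ℕ.<-trans t<p₀ (⟦⟧⁻¹<N w (ℕ.s≤s ℕ.z≤n))
          position = ⟦⟦⟧⟧⁻¹ w t<N
          value<top : w ⟦ t ⟧ < top
          value<top = ℕ.≤∧≢⇒< (ℕ.s≤s⁻¹ (⟦⟧<N w t<N))
                        (λ value≡top → ℕ.<-irrefl (trans (sym position) (cong (w ⟦_⟧⁻¹) value≡top)) (ℕ.<-trans t<p₀ p₀<pₜ))
          run : ∀ s → t ≤ s → s < p₀ → Ascent w s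
          run s t≤s s<p₀ = proj₁ (outer (w ⟦ t ⟧) (ℕ.≮⇒≥ wt≮f) value<top s) (subst (_≤ s) (sym position) t≤s) (ℕ.<-trans s<p₀ p₀<pₜ)
      late : ∀ t → pₜ < t → t < suc top → f ≤ w ⟦ t ⟧
      late t pₜ<t t<N with w ⟦ t ⟧ ℕ.<? f
      ... | no  wt≮f = ℕ.≮⇒≥ wt≮f
      ... | yes wt<f = ⊥-elim (ℕ.<⇒≱ (ℕ.<-≤-trans (subst (_< w ⟦ t ⟧) value-pₜ (ascending-run w run pₜ<t)) (ℕ.<⇒≤ wt<f)) f≤top)
        where
          position = ⟦⟦⟧⟧⁻¹ w t<N
          value≢0 : w ⟦ t ⟧ ≢ 0
          value≢0 value≡0 = ℕ.<-irrefl (trans (cong (w ⟦_⟧⁻¹) (sym value≡0)) position) (ℕ.<-trans p₀<pₜ pₜ<t)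
          run : ∀ s → pₜ ≤ s → s < t → Ascent w s
          run s pₜ≤s s<t = proj₁ (inner (w ⟦ t ⟧) (ℕ.n≢0⇒n>0 value≢0) wt<f s) (ℕ.≤-trans (ℕ.<⇒≤ p₀<pₜ) pₜ≤s) (subst (s <_) (sym position) s<t)
      downward : ∀ s t → s < t → t < suc top → w ⟦ t ⟧ < f → w ⟦ s ⟧ < f
      downward s t s<t t<N wt<f with ℕ.<-cmp s p₀
      ... | tri< s<p₀ _ _ = early s s<p₀
      ... | tri≈ _ refl _ = subst (_< f) (sym value-p₀) 0<f
      ... | tri> _ _ p₀<s = ℕ.<-trans (ascending-run w (λ r s≤r r<t → rising r (ℕ.≤-trans (ℕ.<⇒≤ p₀<s) s≤r) (ℕ.<-≤-trans r<t t≤pₜ)) s<t) wt<f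
        where t≤pₜ = ℕ.≮⇒≥ (λ pₜ<t → ℕ.<⇒≱ wt<f (late t pₜ<t t<N))

module BlockForm {n m : ℕ} (pf : m ℕ.≤ n) (u : Permutation′ (n ℕ.∸ m)) (v : Permutation′ m) where
  open Positions
  open Blocks using (Embeds)
  open import Data.Nat as ℕ using (_≤_; _<_; _+_; _∸_; _<?_)
  import Data.Nat.Properties as ℕ
  open import Data.Fin using (toℕ; fromℕ<; splitAt; cast; _↑ˡ_; _↑ʳ_)
  import Data.Fin.Properties as Fin
  open import Data.Fin.Permutation using (_⟨$⟩ʳ_)
  open import Data.Product using (_×_; _,_)
  open import Data.Sum using (inj₁; inj₂)
  open import Data.Empty using (⊥-elim)
  open import Relation.Binary.PropositionalEquality
  open import Relation.Nullary using (Dec; yes; no)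

  private
    f = n ∸ m
    f+m≡n : f + m ≡ n
    f+m≡n = ℕ.m∸n+n≡m pf

  block-low : ∀ (i : Fin n) → toℕ i < f → toℕ (block n m pf u v i) ≡ u ⟦ toℕ i ⟧
  block-low i i<f with splitAt f (cast (sym f+m≡n) i) in eq
  ... | inj₁ j = begin
    toℕ (cast f+m≡n ((u ⟨$⟩ʳ j) ↑ˡ m))   ≡⟨ trans (Fin.toℕ-cast _ _) (Fin.toℕ-↑ˡ _ m) ⟩
    toℕ (u ⟨$⟩ʳ j)                       ≡⟨ sym (⟦toℕ⟧ u j) ⟩
    u ⟦ toℕ j ⟧                          ≡⟨ cong (u ⟦_⟧) (trans (sym (Fin.toℕ-↑ˡ j m)) (trans (cong toℕ (Fin.splitAt⁻¹-↑ˡ eq)) (Fin.toℕ-cast _ i))) ⟩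
    u ⟦ toℕ i ⟧                          ∎
    where open ≡-Reasoning
  ... | inj₂ j = ⊥-elim (ℕ.<⇒≱ i<f (subst (f ≤_) (trans (sym (Fin.toℕ-↑ʳ f j)) (trans (cong toℕ (Fin.splitAt⁻¹-↑ʳ eq)) (Fin.toℕ-cast _ i)))
                                         (ℕ.m≤m+n f (toℕ j))))

  block-high : ∀ (i : Fin n) t → toℕ i ≡ f + t → toℕ (block n m pf u v i) ≡ f + v ⟦ t ⟧
  block-high i t i≡f+t with splitAt f (cast (sym f+m≡n) i) in eq
  ... | inj₂ j = begin
    toℕ (cast f+m≡n (f ↑ʳ (v ⟨$⟩ʳ j)))   ≡⟨ trans (Fin.toℕ-cast _ _) (Fin.toℕ-↑ʳ f _) ⟩
    f + toℕ (v ⟨$⟩ʳ j)                   ≡⟨ cong (f +_) (sym (⟦toℕ⟧ v j)) ⟩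
    f + v ⟦ toℕ j ⟧                      ≡⟨ cong (λ k → f + v ⟦ k ⟧) (ℕ.+-cancelˡ-≡ f _ _ (trans position i≡f+t)) ⟩
    f + v ⟦ t ⟧                          ∎
    where
      open ≡-Reasoning
      position : f + toℕ j ≡ toℕ i
      position = trans (sym (Fin.toℕ-↑ʳ f j)) (trans (cong toℕ (Fin.splitAt⁻¹-↑ʳ eq)) (Fin.toℕ-cast _ i))
  ... | inj₁ j = ⊥-elim (ℕ.<⇒≱ (subst (_< f) position (Fin.toℕ<n j)) (subst (f ≤_) (sym i≡f+t) (ℕ.m≤m+n f t)))
    where
      position : toℕ j ≡ toℕ i
      position = trans (sym (Fin.toℕ-↑ˡ j m)) (trans (cong toℕ (Fin.splitAt⁻¹-↑ˡ eq)) (Fin.toℕ-cast _ i))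

  module _ {w : Permutation′ n} where
    block⇒embeds : (∀ i → w ⟨$⟩ʳ i ≡ block n m pf u v i) → Embeds u w 0 × Embeds v w f
    block⇒embeds w≗block = record { fits = ℕ.m∸n≤m n m ; agrees = low } , record { fits = ℕ.≤-reflexive f+m≡n ; agrees = high }
      where
        low : ∀ t → t < f → w ⟦ t ⟧ ≡ u ⟦ t ⟧
        low t t<f = begin
          w ⟦ t ⟧                                 ≡⟨ ⟦⟧-fromℕ< w t<n ⟩
          toℕ (w ⟨$⟩ʳ fromℕ< t<n)                 ≡⟨ cong toℕ (w≗block _) ⟩
          toℕ (block n m pf u v (fromℕ< t<n))     ≡⟨ block-low _ (subst (_< f) (sym (Fin.toℕ-fromℕ< t<n)) t<f) ⟩
          u ⟦ toℕ (fromℕ< t<n) ⟧                  ≡⟨ cong (u ⟦_⟧) (Fin.toℕ-fromℕ< t<n) ⟩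
          u ⟦ t ⟧                                 ∎
          where
            open ≡-Reasoning
            t<n = ℕ.<-≤-trans t<f (ℕ.m∸n≤m n m)
        high : ∀ t → t < m → w ⟦ f + t ⟧ ≡ f + v ⟦ t ⟧
        high t t<m = begin
          w ⟦ f + t ⟧                             ≡⟨ ⟦⟧-fromℕ< w f+t<n ⟩
          toℕ (w ⟨$⟩ʳ fromℕ< f+t<n)               ≡⟨ cong toℕ (w≗block _) ⟩
          toℕ (block n m pf u v (fromℕ< f+t<n))   ≡⟨ block-high _ t (Fin.toℕ-fromℕ< f+t<n) ⟩
          f + v ⟦ t ⟧                             ∎
          where
            open ≡-Reasoning
            f+t<n = subst (f + t <_) f+m≡n (ℕ.+-monoʳ-< f t<m)

    embeds⇒block : Embeds u w 0 → Embeds v w f → ∀ i → w ⟨$⟩ʳ i ≡ block n m pf u v i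
    embeds⇒block u⊆w v⊆w i = Fin.toℕ-injective (trans (sym (⟦toℕ⟧ w i)) (by-block (toℕ i <? f)))
      where
        by-block : Dec (toℕ i < f) → w ⟦ toℕ i ⟧ ≡ toℕ (block n m pf u v i)
        by-block (yes i<f) = trans (Embeds.agrees u⊆w (toℕ i) i<f) (sym (block-low i i<f))
        by-block (no  i≮f) = begin
          w ⟦ toℕ i ⟧             ≡⟨ cong (w ⟦_⟧) (sym i≡f+t) ⟩
          w ⟦ f + t ⟧             ≡⟨ Embeds.agrees v⊆w t t<m ⟩
          f + v ⟦ t ⟧             ≡⟨ sym (block-high i t (sym i≡f+t)) ⟩
          toℕ (block n m pf u v i) ∎
          where
            open ≡-Reasoning
            t = toℕ i ∸ f
            i≡f+t : f + t ≡ toℕ i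
            i≡f+t = ℕ.m+[n∸m]≡n (ℕ.≮⇒≥ i≮f)
            t<m : t < m
            t<m = ℕ.+-cancelˡ-< f _ _ (subst₂ _<_ (sym i≡f+t) (sym f+m≡n) (Fin.toℕ<n i))

module MiddleChamber {n′ m : ℕ} (pf : m ℕ.≤ suc n′) (1<m : 1 ℕ.< m) (m<n′ : m ℕ.< n′) where
  open Positions
  open Blocks
  open Chambers
  open WCharacterisation {n′}
  open import Data.Nat as ℕ using (suc; _≤_; _<_; _+_; _∸_)
  import Data.Nat.Properties as ℕ
  open import Data.Fin using (opposite)
  import Data.Fin.Properties as Fin
  open import Data.Fin.Permutation using (_⟨$⟩ʳ_; reverse; _∘ₚ_)
  open import Data.Product using (Σ; _×_; _,_; proj₁; proj₂)
  open import Data.Sum using (_⊎_; inj₁; inj₂)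
  open import Data.Empty using (⊥-elim)
  open import Function using (mk⇔; Equivalence)
  open import Function.Bundles using (_⇔_)
  open import Relation.Binary.PropositionalEquality
  open import Relation.Binary.Definitions using (Tri; tri<; tri≈; tri>)

  private
    N = suc n′
    f = N ∸ m
    c = m ∸ 1
    2≤f : 2 ≤ f
    2≤f = ℕ.m+n≤o⇒m≤o∸n 2 (ℕ.s≤s m<n′)
    f≤n′ : f ≤ n′
    f≤n′ = ℕ.∸-monoʳ-≤ N (ℕ.<⇒≤ 1<m)
    1+c≡m : suc c ≡ m
    1+c≡m = ℕ.m+[n∸m]≡n (ℕ.<⇒≤ 1<m)
    0<f : 0 < f
    0<f = ℕ.<-≤-trans (ℕ.s≤s ℕ.z≤n) 2≤f
    f+c≡n′ : f + c ≡ n′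
    f+c≡n′ = ℕ.suc-injective (trans (sym (ℕ.+-suc f c)) (trans (cong (f +_) 1+c≡m) (ℕ.m∸n+n≡m pf)))

  BlockDecomposition : Permutation′ N → Set
  BlockDecomposition w = Σ (Permutation′ f) λ u → Σ (Permutation′ m) λ v →
             W f (gens1 f) u × W m (gensTop m) v × (∀ i → w ⟨$⟩ʳ i ≡ block N m pf u v i)

  W-mid⇔ : ∀ {w : Permutation′ N} → W N (gensMid N m) w ⇔ DoubleStarCond w f n′
  W-mid⇔ = W-mid {n′} {m} 0<f f≤n′

  blocks-of-mid : ∀ {w} → W N (gensMid N m) w → w ⟦ 0 ⟧⁻¹ < w ⟦ n′ ⟧⁻¹ → BlockDecomposition w
  blocks-of-mid {w} Wh p₀<pₜ = u , v , W-u , W-v , BlockForm.embeds⇒block pf u v u⊆w v⊆w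
    where
      cond = Equivalence.to W-mid⇔ Wh
      halves = split-blocks (ℕ.m∸n+n≡m pf) (preserves-initial cond 0<f f≤n′ p₀<pₜ)
      u = proj₁ (proj₁ halves)
      u⊆w = proj₂ (proj₁ halves)
      v = proj₁ (proj₂ halves)
      v⊆w = proj₂ (proj₂ halves)
      W-u = Equivalence.from (W-gens1⇔StarCond u 2≤f) (StarCond-restrict u⊆w cond)
      W-v = Equivalence.from (W-gensTop⇔TopCond v 1<m) (TopCond-restrict 1+c≡m v⊆w (subst (DoubleStarCond w f) (sym f+c≡n′) cond))

  mid-of-blocks : ∀ {w} → BlockDecomposition w → W N (gensMid N m) w
  mid-of-blocks {w} (u , v , W-u , W-v , w≗block) = Equivalence.from W-mid⇔ (subst (DoubleStarCond w f) f+c≡n′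
    (DoubleStarCond-extend 1+c≡m u⊆w v⊆w (Equivalence.to (W-gens1⇔StarCond u 2≤f) W-u) (Equivalence.to (W-gensTop⇔TopCond v 1<m) W-v) 0<f))
    where
      open BlockForm pf u v
      u⊆w = proj₁ (block⇒embeds w≗block)
      v⊆w = proj₂ (block⇒embeds w≗block)

  DecompositionUpToReversal : Permutation′ N → Set
  DecompositionUpToReversal w = Σ (Permutation′ f) (λ u → Σ (Permutation′ m) (λ v →
      W f (gens1 f) u × W m (gensTop m) v ×
      ((∀ i → w ⟨$⟩ʳ i ≡ block N m pf u v i) ⊎ (∀ i → w ⟨$⟩ʳ i ≡ block N m pf u v (opposite i)))))

  mid-chamber : (w : Permutation′ N) → W N (gensMid N m) w ⇔ DecompositionUpToReversal w
  mid-chamber w = mk⇔ to from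
    where
      0<N : 0 < N
      0<N = ℕ.s≤s ℕ.z≤n
      w′ : Permutation′ N
      w′ = reverse ∘ₚ w
      to : W N (gensMid N m) w → DecompositionUpToReversal w
      to Wh = by-order (ℕ.<-cmp (w ⟦ 0 ⟧⁻¹) (w ⟦ n′ ⟧⁻¹))
        where
          by-order : Tri (w ⟦ 0 ⟧⁻¹ < w ⟦ n′ ⟧⁻¹) (w ⟦ 0 ⟧⁻¹ ≡ w ⟦ n′ ⟧⁻¹) (w ⟦ n′ ⟧⁻¹ < w ⟦ 0 ⟧⁻¹) → DecompositionUpToReversal w
          by-order (tri< p₀<pₜ _ _) =
            let (u , v , W-u , W-v , w≗block) = blocks-of-mid {w} Wh p₀<pₜ
            in  u , v , W-u , W-v , inj₁ w≗block
          by-order (tri≈ _ p₀≡pₜ _) = ⊥-elim (ℕ.<-irrefl (⟦⟧⁻¹-injective w 0<N ℕ.≤-refl p₀≡pₜ) (ℕ.<-trans (ℕ.s≤s ℕ.z≤n) (ℕ.<-trans 1<m m<n′)))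
          by-order (tri> _ _ pₜ<p₀) =
            let (u , v , W-u , W-v , w′≗block) = blocks-of-mid {w′} (W-reverse {gens = gensMid N m} {w = w} Wh) reversed
            in  u , v , W-u , W-v , inj₂ (λ i → trans (cong (w ⟨$⟩ʳ_) (sym (Fin.opposite-involutive i))) (w′≗block (opposite i)))
            where
              reversed : w′ ⟦ 0 ⟧⁻¹ < w′ ⟦ n′ ⟧⁻¹
              reversed = subst₂ _<_ (sym (reverse-position w 0<N)) (sym (reverse-position w ℕ.≤-refl))
                           (ℕ.∸-monoʳ-< (ℕ.s≤s pₜ<p₀) (⟦⟧⁻¹<N w 0<N))
      from : DecompositionUpToReversal w → W N (gensMid N m) w
      from (u , v , W-u , W-v , inj₁ w≗block)     = mid-of-blocks {w} (u , v , W-u , W-v , w≗block)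
      from (u , v , W-u , W-v , inj₂ w≗block∘opp) =
        W-cong {w = reverse ∘ₚ w′} {gens = gensMid N m} {w′ = w} (λ i → cong (w ⟨$⟩ʳ_) (Fin.opposite-involutive i))
          (W-reverse {gens = gensMid N m} {w = w′} (mid-of-blocks {w′} (u , v , W-u , W-v , w′≗block)))
        where
          w′≗block : ∀ i → w′ ⟨$⟩ʳ i ≡ block N m pf u v i
          w′≗block i = trans (w≗block∘opp (opposite i)) (cong (block N m pf u v) (Fin.opposite-involutive i))

open import Data.Nat using (ℕ; _∸_; _≤_; _<_)
open import Data.Nat.Properties using (≤-trans; <⇒≤; m∸n≤m)
open import Data.Fin using (Fin; opposite)
open import Data.Fin.Permutation using (Permutation′; _⟨$⟩ʳ_)
open import Data.Product using (Σ; _×_)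
open import Data.Sum using (_⊎_)
open import Function.Bundles using (_⇔_)
open import Relation.Binary.PropositionalEquality using (_≡_)

lemma4p5 : (n m : ℕ) → 4 ≤ n → (h₁ : 1 < m) → (h₂ : m < n ∸ 1) → (w : Permutation′ n) →
    W n (gensMid n m) w
      ⇔ Σ (Permutation′ (n ∸ m)) (λ u → Σ (Permutation′ m) (λ v →
          W (n ∸ m) (gens1 (n ∸ m)) u × W m (gensTop m) v ×
          ((∀ i → w ⟨$⟩ʳ i ≡ block n m (≤-trans (<⇒≤ h₂) (m∸n≤m n 1)) u v i)
           ⊎ (∀ i → w ⟨$⟩ʳ i ≡ block n m (≤-trans (<⇒≤ h₂) (m∸n≤m n 1)) u v (opposite i)))))
lemma4p5 (suc n′) m _ h₁ h₂ = MiddleChamber.mid-chamber (≤-trans (<⇒≤ h₂) (m∸n≤m (suc n′) 1)) h₁ h₂
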